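{- Let $M=M(\phi,\pi^*)$ be a Mallows model on $[n]$ and $\mathcal{B}=S_1,\dots,S_j$ a block structure such that $\pi^*$ satisfies $\mathcal{B}$, and let $\ell=|S_1|+\cdots+|S_j|$. Then $$\Pr_{\pi\sim M}[\pi\in\mathcal{S}_\mathcal{B}]\ge\frac{1}{n^{2\ell}}.$$
   Context: A Mallows model $M(\phi,\pi^*)$ with base permutation $\pi^*$ and scaling parameter $\phi\in(0,1]$ assigns probability $\phi^{d_{KT}(\pi^*,\pi)}/Z_n(\phi)$ to each permutation $\pi$ of $[n]$, where $d_{KT}$ is the Kendall–Tau distance and $Z_n(\phi)$ the normalizing constant. A block structure $\mathcal{B}=S_1,\dots,S_j$ is an ordered collection of disjoint subsets of $[n]$. A permutation $\pi$ satisfies $\mathcal{B}$ (as a block structure) if for each $i$ the elements of $S_i$ occupy consecutive positions $a_i,a_i+1,\dots,a_i+|S_i|-1$ in $\pi$ for some $a_i$, and the blocks occur in the order $S_1,S_2,\dots,S_j$. $\mathcal{S}_\mathcal{B}$ is the set of permutations satisfying $\mathcal{B}$.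
   Formalization: The scaling parameter φ takes only rational values in (0,1]. -}

module Defs where

import Data.Bool
open import Data.Bool using (Bool; true; false; _∧_; _∨_; if_then_else_)
open import Data.Nat as ℕ using (ℕ; zero; suc; _<ᵇ_; _≡ᵇ_; _≤ᵇ_)
open import Data.List using (_++_; List; []; _∷_; map; concatMap; length; upTo; filter; foldr; concat)
open import Data.Product using (_×_; _,_)
open import Data.Rational as ℚ using (ℚ; 0ℚ; 1ℚ)
import Data.Nat.Properties as NP
open import Relation.Nullary.Decidable using (does)

all : {A : Set} → (A → Bool) → List A → Bool
all p = foldr (λ x b → p x ∧ b) true

any : {A : Set} → (A → Bool) → List A → Bool
any p = foldr (λ x b → p x ∨ b) false

_^ℚ_ : ℚ → ℕ → ℚ
φ ^ℚ zero  = 1ℚ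
φ ^ℚ suc k = φ ℚ.* (φ ^ℚ k)

sumℚ : List ℚ → ℚ
sumℚ = foldr ℚ._+_ 0ℚ

-- Permutations of [n] = {0,…,n-1}, written as the list π(0) π(1) … π(n-1)
-- of the elements in position order.

insertEverywhere : {A : Set} → A → List A → List (List A)
insertEverywhere x []       = (x ∷ []) ∷ []
insertEverywhere x (y ∷ ys) = (x ∷ y ∷ ys) ∷ map (y ∷_) (insertEverywhere x ys)

perms : {A : Set} → List A → List (List A)
perms []       = [] ∷ []
perms (x ∷ xs) = concatMap (insertEverywhere x) (perms xs)

Perms : ℕ → List (List ℕ)
Perms n = perms (upTo n)

-- position (0-based) of element x in π (length π if absent)
pos : List ℕ → ℕ → ℕ
pos []      x = 0
pos (y ∷ π) x = if y ≡ᵇ x then 0 else suc (pos π x)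

pairs : {A : Set} → List A → List (A × A)
pairs []      = []
pairs (x ∷ xs) = map (x ,_) xs ++ pairs xs

dKT : List ℕ → List ℕ → ℕ
dKT σ π = length (filter (λ p → ℕ._<?_ (pos σ (proj₂' p)) (pos σ (proj₁' p))) (pairs π))
  where
  proj₁' : ℕ × ℕ → ℕ
  proj₁' (a , _) = a
  proj₂' : ℕ × ℕ → ℕ
  proj₂' (_ , b) = b

-- Block structures: an ordered list S_1,…,S_j of blocks, each block a list
-- of (distinct) elements of [n].

BlockStructure : Set
BlockStructure = List (List ℕ)

-- S occupies consecutive positions a, a+1, …, a+|S|-1 of π for some a
-- (a ranges over 0..length π, which covers every possible start)
consecutive : List ℕ → List ℕ → Bool
consecutive π S =
  any (λ a → all (λ x → (a ≤ᵇ pos π x) ∧ (pos π x <ᵇ a ℕ.+ length S)) S)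
      (upTo (suc (length π)))

before : List ℕ → List ℕ → List ℕ → Bool
before π S T = all (λ x → all (λ y → pos π x <ᵇ pos π y) T) S

inOrder : List ℕ → BlockStructure → Bool
inOrder π []      = true
inOrder π (S ∷ B) = all (before π S) B ∧ inOrder π B

satisfies : List ℕ → BlockStructure → Bool
satisfies π B = all (consecutive π) B ∧ inOrder π B

totalSize : BlockStructure → ℕ
totalSize B = length (concat B)

-- Mallows model M(φ, π*) on [n]: unnormalised weights φ^{dKT(π*,π)}.

weight : ℚ → List ℕ → List ℕ → ℚ
weight φ πstar π = φ ^ℚ dKT πstar π

Z : ℕ → ℚ → List ℕ → ℚ
Z n φ πstar = sumℚ (map (weight φ πstar) (Perms n))

-- unnormalised mass of S_B: Σ_{π ∈ S_B} φ^{dKT(π*,π)},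
-- so that Pr_{π∼M}[π ∈ S_B] = massB / Z
massB : ℕ → ℚ → List ℕ → BlockStructure → ℚ
massB n φ πstar B =
  sumℚ (map (weight φ πstar) (filter (λ π → satisfies π B Data.Bool.≟ true) (Perms n)))

module Submission where

-- Rank elements by their position r in π*. For a permutation π, split it into its free part u
-- (elements outside the blocks, in π-order) and its block part; the inversions of π are those
-- inside u, those inside the block part, and the cross inversions, where a block element x
-- sitting after g free elements contributes cost x u g. The map improve keeps u and inserts
-- each block, sorted by r, contiguously at the gap that is optimal for its first element.
-- Because a block is contiguous in π*, all its elements compare alike with every free element,
-- so they share one cost function; and by a Monge property of cost the optimal gap is monotone
-- in r, so the blocks come out in order. Thus improve π satisfies B and has no more inversions
-- than π, i.e. at least the same weight. Finally π is determined by improve π together with the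
-- positions in π of the ℓ block elements, a word in [n]^ℓ, whence Z ≤ n^ℓ · massB ≤ n^(2ℓ) · massB.

module MallowsBlocks where

  open import Defs
  open import Algebra.Bundles using (CommutativeMonoid)
  import Algebra.Properties.CommutativeSemigroup as CommutativeSemigroupProperties
  import Data.Bool as Bool
  open import Data.Bool using (Bool; true; false; T; if_then_else_)
  open import Data.Bool.Properties using (T-≡; T-∧)
  import Data.Integer as ℤ
  import Data.Integer.Properties as ℤₚ
  open import Data.List using (List; []; _∷_; _++_; map; length; filter; concat; concatMap; upTo; applyUpTo; take; drop;
                               cartesianProduct; cartesianProductWith)
  open import Data.List.Properties as List using (∷-injective; ∷-injectiveʳ; length-++; length-map; length-upTo;
                                                   filter-accept; filter-reject; filter-all; filter-none; filter-++;
                                                   map-++; ++-assoc; take++drop≡id)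
  open import Data.List.Membership.Propositional using (_∈_; _∉_; lose; find)
  open import Data.List.Membership.Propositional.Properties
  open import Data.List.Relation.Binary.Disjoint.Propositional using (Disjoint)
  open import Data.List.Relation.Binary.Permutation.Propositional
    using (_↭_; ↭-refl; ↭-sym; ↭-trans; ↭-reflexive; prep; swap; ↭⇒↭ₛ; ↭ₛ⇒↭; module PermutationReasoning)
  open import Data.List.Relation.Binary.Permutation.Propositional.Properties
    using (∈-resp-↭; ↭-empty-inv; ↭-length; drop-mid; shift; shifts; ++⁺ˡ; ++-comm; map⁺; filter-↭)
  import Data.List.Relation.Binary.Permutation.Setoid.Properties as PermutationSetoid
  open import Data.List.Relation.Binary.Pointwise using (Pointwise; []; _∷_)
  open import Data.List.Relation.Binary.Subset.Propositional using (_⊆_)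
  open import Data.List.Relation.Unary.All as All using (All; []; _∷_)
  import Data.List.Relation.Unary.All.Properties as All
  open import Data.List.Relation.Unary.AllPairs as AllPairs using (AllPairs; []; _∷_)
  import Data.List.Relation.Unary.AllPairs.Properties as AllPairs
  open import Data.List.Relation.Unary.Any as Any using (Any; here; there)
  open import Data.List.Relation.Unary.Unique.Propositional using (Unique)
  import Data.List.Relation.Unary.Unique.Propositional.Properties as Unique
  open import Data.Nat using (ℕ; zero; suc; _+_; _∸_; _*_; _^_; _≤_; _<_; z≤n; s≤s; z<s; _≟_; _<?_; _≤?_; _<ᵇ_)
  open import Data.Nat.Properties
  open import Data.Nat.ListAction using (sum)
  open import Data.Nat.ListAction.Properties using (sum-++; sum-↭)
  open import Data.Nat.Solver using (module +-*-Solver)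
  import Data.Nat.Coprimality as Coprime
  open import Data.List.Membership.DecPropositional _≟_ using (_∈?_)
  open import Data.Product using (_×_; _,_; proj₁; proj₂; map₂; uncurry; ∃-syntax)
  open import Data.Rational as ℚ using (ℚ; 0ℚ; 1ℚ; mkℚ)
  import Data.Rational.Properties as ℚₚ
  import Data.Sign as Sign
  open import Data.Sum using (inj₁; inj₂; [_,_]′)
  open import Function using (_∘_; _⇔_; mk⇔; Equivalence)
  open import Level using (0ℓ)
  open import Relation.Binary.Definitions using (tri<; tri≈; tri>)
  open import Relation.Binary.PropositionalEquality
    using (_≡_; _≢_; setoid; refl; sym; trans; cong; cong₂; subst; subst₂; module ≡-Reasoning)
  open import Relation.Nullary using (¬_; ¬?; Dec; yes; no; contradiction)
  open import Relation.Nullary.Decidable using (dec-true; dec-false)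
  open import Relation.Unary using (Pred; Decidable; ∁)
  open import Relation.Unary.Properties using (∁?)

  open Equivalence using (to; from)
  open CommutativeSemigroupProperties +-commutativeSemigroup using (interchange; x∙yz≈y∙xz)
  open CommutativeSemigroupProperties (CommutativeMonoid.commutativeSemigroup ℚₚ.+-0-commutativeMonoid)
    using () renaming (x∙yz≈y∙xz to ℚ-x∙yz≈y∙xz)

  -- Lists

  AllPairs-mapWith : ∀ {A : Set} {Q : A → Set} {R S : A → A → Set} {xs} →
                     (∀ {x y} → Q x → Q y → R x y → S x y) → All Q xs → AllPairs R xs → AllPairs S xs
  AllPairs-mapWith f []         []         = []
  AllPairs-mapWith f (qx ∷ qxs) (rx ∷ rxs) =
    All.zipWith (λ (qy , rxy) → f qx qy rxy) (qxs , rx) ∷ AllPairs-mapWith f qxs rxs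

  ⊆-dropMid : ∀ {A : Set} {x : A} {xs} αs βs → x ∉ xs → xs ⊆ αs ++ x ∷ βs → xs ⊆ αs ++ βs
  ⊆-dropMid αs βs x∉xs xs⊆ z∈xs with ∈-++⁻ αs (xs⊆ z∈xs)
  ... | inj₁ z∈αs         = ∈-++⁺ˡ z∈αs
  ... | inj₂ (here refl)  = contradiction z∈xs x∉xs
  ... | inj₂ (there z∈βs) = ∈-++⁺ʳ αs z∈βs

  Unique-⊆⇒length≤ : ∀ {A : Set} {xs ys : List A} → Unique xs → xs ⊆ ys → length xs ≤ length ys
  Unique-⊆⇒length≤ {xs = []}     _           _    = z≤n
  Unique-⊆⇒length≤ {xs = x ∷ xs} u@(_ ∷ uxs) x∷xs⊆ys with ∈-∃++ (x∷xs⊆ys (here refl))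
  ... | αs , βs , refl = begin
    suc (length xs)             ≤⟨ s≤s (Unique-⊆⇒length≤ uxs xs⊆αβ) ⟩
    suc (length (αs ++ βs))     ≡⟨ cong suc (length-++ αs) ⟩
    suc (length αs + length βs) ≡⟨ sym (+-suc (length αs) (length βs)) ⟩
    length αs + length (x ∷ βs) ≡⟨ sym (length-++ αs) ⟩
    length (αs ++ x ∷ βs)       ∎
    where
    open ≤-Reasoning
    xs⊆αβ = ⊆-dropMid αs βs (Unique.Unique[x∷xs]⇒x∉xs u) (x∷xs⊆ys ∘ there)

  Unique-++⁻ : ∀ {A : Set} (xs : List A) {ys} → Unique (xs ++ ys) → Unique xs × Unique ys × Disjoint xs ys
  Unique-++⁻ []       u           = [] , u , λ ()
  Unique-++⁻ (x ∷ xs) (x∉ ∷ uxsys) =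
    let (uxs , uys , disj) = Unique-++⁻ xs uxsys in
    All.++⁻ˡ xs x∉ ∷ uxs , uys , λ where
      (here refl , v∈ys) → All.lookup (All.++⁻ʳ xs x∉) v∈ys refl
      (there v∈xs , v∈ys) → disj (v∈xs , v∈ys)

  Unique-concat⁻ : ∀ {A : Set} {xss : List (List A)} → Unique (concat xss) → All Unique xss
  Unique-concat⁻ {xss = []}       _ = []
  Unique-concat⁻ {xss = xs ∷ xss} u = let (uxs , uxss , _) = Unique-++⁻ xs u in uxs ∷ Unique-concat⁻ uxss

  Unique-resp-↭ : ∀ {A : Set} {xs ys : List A} → xs ↭ ys → Unique xs → Unique ys
  Unique-resp-↭ {A} xs↭ys = PermutationSetoid.Unique-resp-↭ (setoid A) (↭⇒↭ₛ xs↭ys)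

  Unique-map⁺-injectiveOn : ∀ {A B : Set} (f : A → B) {xs} → (∀ {x y} → x ∈ xs → y ∈ xs → f x ≡ f y → x ≡ y) →
                Unique xs → Unique (map f xs)
  Unique-map⁺-injectiveOn f {[]}     _      []          = []
  Unique-map⁺-injectiveOn f {x ∷ xs} f-inj (x∉ ∷ uxs) =
    All.map⁺ (All.tabulate (λ y∈ fx≡fy → All.lookup x∉ y∈ (f-inj (here refl) (there y∈) fx≡fy))) ∷
    Unique-map⁺-injectiveOn f (λ x∈ y∈ → f-inj (there x∈) (there y∈)) uxs

  map-≡⇒≡ : ∀ {A B : Set} {f g : A → B} {xs x} → map f xs ≡ map g xs → x ∈ xs → f x ≡ g x
  map-≡⇒≡ {xs = _ ∷ _} eq (here refl) = proj₁ (∷-injective eq)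
  map-≡⇒≡ {xs = _ ∷ _} eq (there x∈)  = map-≡⇒≡ (proj₂ (∷-injective eq)) x∈

  Pointwise-map⁺ : ∀ {A B : Set} {R : A → B → Set} {f : A → B} {xs} → All (λ x → R x (f x)) xs → Pointwise R xs (map f xs)
  Pointwise-map⁺ []         = []
  Pointwise-map⁺ (px ∷ pxs) = px ∷ Pointwise-map⁺ pxs

  filter-cong-All : ∀ {A : Set} {P Q : Pred A 0ℓ} (P? : Decidable P) (Q? : Decidable Q) {xs} →
                    All (λ x → P x ⇔ Q x) xs → filter P? xs ≡ filter Q? xs
  filter-cong-All P? Q? {[]}     []       = refl
  filter-cong-All P? Q? {x ∷ xs} (P⇔Q ∷ h) with P? x | Q? x
  ... | yes _  | yes _  = cong (x ∷_) (filter-cong-All P? Q? h)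
  ... | no  _  | no  _  = filter-cong-All P? Q? h
  ... | yes Px | no ¬Qx = contradiction (to P⇔Q Px) ¬Qx
  ... | no ¬Px | yes Qx = contradiction (from P⇔Q Qx) ¬Px

  filter-∁-↭ : ∀ {A : Set} {P : Pred A 0ℓ} (P? : Decidable P) xs → xs ↭ filter P? xs ++ filter (∁? P?) xs
  filter-∁-↭ {A} P? xs = subst (λ (ys , zs) → xs ↭ ys ++ zs) (List.partition-defn P? xs)
                                (↭ₛ⇒↭ (PermutationSetoid.partition-↭ (setoid A) P? xs))

  filter-∈-++-↭ : ∀ {S S′} xs → Disjoint S S′ → filter (_∈? S ++ S′) xs ↭ filter (_∈? S) xs ++ filter (_∈? S′) xs
  filter-∈-++-↭         []       _    = ↭-refl
  filter-∈-++-↭ {S} {S′} (x ∷ xs) disj = by-cases (x ∈? S) (x ∈? S′)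
    where
    open PermutationReasoning
    ih = filter-∈-++-↭ xs disj
    by-cases : Dec (x ∈ S) → Dec (x ∈ S′) →
               filter (_∈? S ++ S′) (x ∷ xs) ↭ filter (_∈? S) (x ∷ xs) ++ filter (_∈? S′) (x ∷ xs)
    by-cases (yes x∈S) (yes x∈S′) = contradiction (x∈S , x∈S′) disj
    by-cases (yes x∈S) (no  x∉S′) = begin
      filter (_∈? S ++ S′) (x ∷ xs)
        ≡⟨ filter-accept (_∈? S ++ S′) (∈-++⁺ˡ x∈S) ⟩
      x ∷ filter (_∈? S ++ S′) xs
        <⟨ ih ⟩
      x ∷ filter (_∈? S) xs ++ filter (_∈? S′) xs
        ≡⟨ sym (cong₂ _++_ (filter-accept (_∈? S) x∈S) (filter-reject (_∈? S′) x∉S′)) ⟩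
      filter (_∈? S) (x ∷ xs) ++ filter (_∈? S′) (x ∷ xs) ∎
    by-cases (no  x∉S) (yes x∈S′) = begin
      filter (_∈? S ++ S′) (x ∷ xs)
        ≡⟨ filter-accept (_∈? S ++ S′) (∈-++⁺ʳ S x∈S′) ⟩
      x ∷ filter (_∈? S ++ S′) xs
        <⟨ ih ⟩
      x ∷ filter (_∈? S) xs ++ filter (_∈? S′) xs
        ↭⟨ ↭-sym (shift x (filter (_∈? S) xs) _) ⟩
      filter (_∈? S) xs ++ x ∷ filter (_∈? S′) xs
        ≡⟨ sym (cong₂ _++_ (filter-reject (_∈? S) x∉S) (filter-accept (_∈? S′) x∈S′)) ⟩
      filter (_∈? S) (x ∷ xs) ++ filter (_∈? S′) (x ∷ xs) ∎
    by-cases (no  x∉S) (no  x∉S′) = begin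
      filter (_∈? S ++ S′) (x ∷ xs)
        ≡⟨ filter-reject (_∈? S ++ S′) ([ x∉S , x∉S′ ]′ ∘ ∈-++⁻ S) ⟩
      filter (_∈? S ++ S′) xs
        ↭⟨ ih ⟩
      filter (_∈? S) xs ++ filter (_∈? S′) xs
        ≡⟨ sym (cong₂ _++_ (filter-reject (_∈? S) x∉S) (filter-reject (_∈? S′) x∉S′)) ⟩
      filter (_∈? S) (x ∷ xs) ++ filter (_∈? S′) (x ∷ xs) ∎

  filter-∈-concat-↭ : ∀ xs {B} → Unique (concat B) → filter (_∈? concat B) xs ↭ concat (map (λ S → filter (_∈? S) xs) B)
  filter-∈-concat-↭ xs {[]}    _   = ↭-reflexive (filter-none (_∈? []) {xs} (All.tabulate (λ _ ())))
  filter-∈-concat-↭ xs {S ∷ B} uSB =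
    let (_ , uB , disj) = Unique-++⁻ S uSB in
    ↭-trans (filter-∈-++-↭ {S} {concat B} xs disj) (++⁺ˡ (filter (_∈? S) xs) (filter-∈-concat-↭ xs {B} uB))

  length-cartesianProductWith : ∀ {A B C : Set} (f : A → B → C) xs ys →
                                length (cartesianProductWith f xs ys) ≡ length xs * length ys
  length-cartesianProductWith f []       ys = refl
  length-cartesianProductWith f (x ∷ xs) ys = begin
    length (map (f x) ys ++ cartesianProductWith f xs ys)
      ≡⟨ length-++ (map (f x) ys) ⟩
    length (map (f x) ys) + length (cartesianProductWith f xs ys)
      ≡⟨ cong₂ _+_ (length-map (f x) ys) (length-cartesianProductWith f xs ys) ⟩
    length ys + length xs * length ys ∎
    where open ≡-Reasoning

  ∈-window : ∀ {c k v} → c ≤ v → v < c + k → v ∈ applyUpTo (c +_) k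
  ∈-window {c} {k} {v} c≤v v<c+k = subst (_∈ applyUpTo (c +_) k) (m+[n∸m]≡n c≤v)
    (∈-applyUpTo⁺ (c +_) (subst (v ∸ c <_) (m+n∸m≡n c k) (∸-monoˡ-< v<c+k c≤v)))

  -- Natural-number arithmetic and argmin

  sum-map-mono : ∀ {A : Set} {f g : A → ℕ} xs → (∀ {a} → a ∈ xs → f a ≤ g a) → sum (map f xs) ≤ sum (map g xs)
  sum-map-mono []       f≤g = z≤n
  sum-map-mono (x ∷ xs) f≤g = +-mono-≤ (f≤g (here refl)) (sum-map-mono xs (f≤g ∘ there))

  +-mono-≤-interchange : ∀ {a b c d a′ b′ c′ d′} → a + b ≤ c + d → a′ + b′ ≤ c′ + d′ →
                         (a + a′) + (b + b′) ≤ (c + c′) + (d + d′)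
  +-mono-≤-interchange {a} {b} {c} {d} {a′} {b′} {c′} {d′} p q =
    subst₂ _≤_ (interchange a b a′ b′) (interchange c d c′ d′) (+-mono-≤ p q)

  ^≤^2* : ∀ n ℓ → n ^ ℓ ≤ n ^ (2 * ℓ)
  ^≤^2* zero      zero    = ≤-refl
  ^≤^2* zero      (suc ℓ) = z≤n
  ^≤^2* n@(suc _) ℓ       = ^-monoʳ-≤ n (m≤m+n ℓ (ℓ + 0))

  module Argmin (f : ℕ → ℕ) where

    argmin : ℕ → ℕ
    argmin zero    = 0
    argmin (suc m) with f (suc m) <? f (argmin m)
    ... | yes _ = suc m
    ... | no  _ = argmin m

    argmin-≤ : ∀ m → argmin m ≤ m
    argmin-≤ zero    = z≤n
    argmin-≤ (suc m) with f (suc m) <? f (argmin m)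
    ... | yes _ = ≤-refl
    ... | no  _ = m≤n⇒m≤1+n (argmin-≤ m)

    argmin-minimal : ∀ {m h} → h ≤ m → f (argmin m) ≤ f h
    argmin-minimal {zero}  z≤n = ≤-refl
    argmin-minimal {suc m} {h} h≤1+m with f (suc m) <? f (argmin m) | m≤n⇒m<n∨m≡n h≤1+m
    ... | yes _   | inj₂ refl      = ≤-refl
    ... | yes fm< | inj₁ (s≤s h≤m) = <⇒≤ (<-≤-trans fm< (argmin-minimal h≤m))
    ... | no  fm≮ | inj₂ refl      = ≮⇒≥ fm≮
    ... | no  _   | inj₁ (s≤s h≤m) = argmin-minimal h≤m

    argmin-leftmost : ∀ m {h} → h < argmin m → f (argmin m) < f h
    argmin-leftmost (suc m) h<am with f (suc m) <? f (argmin m)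
    ... | yes fm< = <-≤-trans fm< (argmin-minimal (≤-pred h<am))
    ... | no  _   = argmin-leftmost m h<am

  open Argmin using (argmin; argmin-≤; argmin-minimal; argmin-leftmost)

  argmin-mono : ∀ (f f′ : ℕ → ℕ) m → (∀ {g′ g} → g′ ≤ g → f′ g + f g′ ≤ f′ g′ + f g) → argmin f m ≤ argmin f′ m
  argmin-mono f f′ m monge with argmin f m ≤? argmin f′ m
  ... | yes a≤a′ = a≤a′
  ... | no  a≰a′ = contradiction (argmin-minimal f′ (argmin-≤ f m)) (<⇒≱ f′a<f′a′)
    where
    a  = argmin f m
    a′ = argmin f′ m
    a′<a : a′ < a
    a′<a = ≰⇒> a≰a′
    f′a<f′a′ : f′ a < f′ a′
    f′a<f′a′ = +-cancelʳ-< (f a′) (f′ a) (f′ a′)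
                 (≤-<-trans (monge (<⇒≤ a′<a)) (+-monoʳ-< (f′ a′) (argmin-leftmost f m a′<a)))

  -- Sums of rationals

  sumℚ-++ : ∀ xs ys → sumℚ (xs ++ ys) ≡ sumℚ xs ℚ.+ sumℚ ys
  sumℚ-++ []       ys = sym (ℚₚ.+-identityˡ (sumℚ ys))
  sumℚ-++ (x ∷ xs) ys = trans (cong (x ℚ.+_) (sumℚ-++ xs ys)) (sym (ℚₚ.+-assoc x (sumℚ xs) (sumℚ ys)))

  sumℚ-mono : ∀ {A : Set} {f g : A → ℚ} xs → (∀ {a} → a ∈ xs → f a ℚ.≤ g a) → sumℚ (map f xs) ℚ.≤ sumℚ (map g xs)
  sumℚ-mono []       f≤g = ℚₚ.≤-refl
  sumℚ-mono (x ∷ xs) f≤g = ℚₚ.+-mono-≤ (f≤g (here refl)) (sumℚ-mono xs (f≤g ∘ there))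

  sumℚ-nonNeg : ∀ {A : Set} {g : A → ℚ} → (∀ a → 0ℚ ℚ.≤ g a) → ∀ xs → 0ℚ ℚ.≤ sumℚ (map g xs)
  sumℚ-nonNeg g≥0 []       = ℚₚ.≤-refl
  sumℚ-nonNeg g≥0 (x ∷ xs) = ℚₚ.+-mono-≤ (g≥0 x) (sumℚ-nonNeg g≥0 xs)

  sumℚ-⊆ : ∀ {A : Set} {g : A → ℚ} {xs ys} → (∀ a → 0ℚ ℚ.≤ g a) → Unique xs → xs ⊆ ys →
           sumℚ (map g xs) ℚ.≤ sumℚ (map g ys)
  sumℚ-⊆ {ys = ys} g≥0 []          _ = sumℚ-nonNeg g≥0 ys
  sumℚ-⊆ {g = g} {x ∷ xs} g≥0 u@(_ ∷ uxs) x∷xs⊆ys with ∈-∃++ (x∷xs⊆ys (here refl))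
  ... | αs , βs , refl = begin
    g x ℚ.+ sumℚ (map g xs)                       ≤⟨ ℚₚ.+-monoʳ-≤ (g x) (sumℚ-⊆ g≥0 uxs xs⊆αβ) ⟩
    g x ℚ.+ sumℚ (map g (αs ++ βs))               ≡⟨ cong (g x ℚ.+_) (sumℚ-map-++ αs βs) ⟩
    g x ℚ.+ (sumℚ (map g αs) ℚ.+ sumℚ (map g βs)) ≡⟨ ℚ-x∙yz≈y∙xz (g x) (sumℚ (map g αs)) (sumℚ (map g βs)) ⟩
    sumℚ (map g αs) ℚ.+ (g x ℚ.+ sumℚ (map g βs)) ≡⟨ sym (sumℚ-map-++ αs (x ∷ βs)) ⟩
    sumℚ (map g (αs ++ x ∷ βs))                   ∎
    where
    open ℚₚ.≤-Reasoning
    sumℚ-map-++ : ∀ αs βs → sumℚ (map g (αs ++ βs)) ≡ sumℚ (map g αs) ℚ.+ sumℚ (map g βs)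
    sumℚ-map-++ αs βs = trans (cong sumℚ (map-++ g αs βs)) (sumℚ-++ (map g αs) (map g βs))
    xs⊆αβ = ⊆-dropMid αs βs (Unique.Unique[x∷xs]⇒x∉xs u) (x∷xs⊆ys ∘ there)

  toℚ : ℕ → ℚ
  toℚ k = ℤ.+ k ℚ./ 1

  toℚ-mkℚ : ∀ k → toℚ k ≡ mkℚ (ℤ.+ k) 0 (Coprime.sym (Coprime.1-coprimeTo k))
  toℚ-mkℚ k = ℚₚ.normalize-coprime (Coprime.sym (Coprime.1-coprimeTo k))

  toℚ-suc : ∀ k → toℚ (suc k) ≡ 1ℚ ℚ.+ toℚ k
  toℚ-suc k = begin
    ℤ.+ suc k ℚ./ 1                                       ≡⟨ cong (λ m → ℤ.+ suc m ℚ./ 1) (sym (*-identityʳ k)) ⟩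
    ℤ.+ suc (k * 1) ℚ./ 1                                 ≡⟨ cong (λ i → (ℤ.+ 1 ℤ.+ i) ℚ./ 1) (sym (ℤₚ.+◃n≡+n (k * 1))) ⟩
    (ℤ.+ 1 ℤ.+ (Sign.+ ℤ.◃ k * 1)) ℚ./ 1                    ≡⟨⟩
    1ℚ ℚ.+ mkℚ (ℤ.+ k) 0 (Coprime.sym (Coprime.1-coprimeTo k)) ≡⟨ cong (1ℚ ℚ.+_) (sym (toℚ-mkℚ k)) ⟩
    1ℚ ℚ.+ toℚ k                                        ∎
    where open ≡-Reasoning

  toℚ-mono : ∀ {a b} → a ≤ b → toℚ a ℚ.≤ toℚ b
  toℚ-mono {a} {b} a≤b rewrite toℚ-mkℚ a | toℚ-mkℚ b = ℚ.*≤* (ℤₚ.*-monoʳ-≤-nonNeg (ℤ.+ 1) (ℤ.+≤+ a≤b))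

  sumℚ-cartesianProduct : ∀ {A K : Set} (w : A → ℚ) (C : List K) (S : List A) →
                          sumℚ (map (w ∘ proj₂) (cartesianProduct C S)) ≡ toℚ (length C) ℚ.* sumℚ (map w S)
  sumℚ-cartesianProduct w []      S = sym (ℚₚ.*-zeroˡ (sumℚ (map w S)))
  sumℚ-cartesianProduct w (c ∷ C) S = begin
    sumℚ (map (w ∘ proj₂) (map (c ,_) S ++ cartesianProduct C S))
      ≡⟨ cong sumℚ (map-++ (w ∘ proj₂) (map (c ,_) S) _) ⟩
    sumℚ (map (w ∘ proj₂) (map (c ,_) S) ++ map (w ∘ proj₂) (cartesianProduct C S))
      ≡⟨ sumℚ-++ (map (w ∘ proj₂) (map (c ,_) S)) _ ⟩
    sumℚ (map (w ∘ proj₂) (map (c ,_) S)) ℚ.+ sumℚ (map (w ∘ proj₂) (cartesianProduct C S))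
      ≡⟨ cong₂ ℚ._+_ (cong sumℚ (sym (List.map-∘ S))) (sumℚ-cartesianProduct w C S) ⟩
    s ℚ.+ toℚ (length C) ℚ.* s
      ≡⟨ cong (ℚ._+ toℚ (length C) ℚ.* s) (sym (ℚₚ.*-identityˡ s)) ⟩
    1ℚ ℚ.* s ℚ.+ toℚ (length C) ℚ.* s
      ≡⟨ sym (ℚₚ.*-distribʳ-+ s 1ℚ (toℚ (length C))) ⟩
    (1ℚ ℚ.+ toℚ (length C)) ℚ.* s
      ≡⟨ cong (ℚ._* s) (sym (toℚ-suc (length C))) ⟩
    toℚ (suc (length C)) ℚ.* s ∎
    where
    open ≡-Reasoning
    s = sumℚ (map w S)

  sumℚ-≤-coding : ∀ {A K : Set} (w : A → ℚ) (F : A → A) (code : A → K) {P S : List A} {C : List K} →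
    (∀ a → 0ℚ ℚ.≤ w a) → Unique P → (∀ {a} → a ∈ P → w a ℚ.≤ w (F a)) →
    (∀ {a} → a ∈ P → F a ∈ S) → (∀ {a} → a ∈ P → code a ∈ C) →
    (∀ {a b} → a ∈ P → b ∈ P → code a ≡ code b → F a ≡ F b → a ≡ b) →
    sumℚ (map w P) ℚ.≤ toℚ (length C) ℚ.* sumℚ (map w S)
  sumℚ-≤-coding w F code {P} {S} {C} w≥0 uP w≤wF F∈S code∈C coding-injective = begin
    sumℚ (map w P)                                      ≤⟨ sumℚ-mono P w≤wF ⟩
    sumℚ (map (w ∘ F) P)                                ≡⟨ cong sumℚ (List.map-∘ P) ⟩
    sumℚ (map (w ∘ proj₂) (map h P))                    ≤⟨ sumℚ-⊆ (w≥0 ∘ proj₂) unique-h[P] h[P]⊆C×S ⟩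
    sumℚ (map (w ∘ proj₂) (cartesianProduct C S))       ≡⟨ sumℚ-cartesianProduct w C S ⟩
    toℚ (length C) ℚ.* sumℚ (map w S)                   ∎
    where
    open ℚₚ.≤-Reasoning
    h : _ → _
    h a = code a , F a
    h-injective : ∀ {a b} → a ∈ P → b ∈ P → h a ≡ h b → a ≡ b
    h-injective a∈ b∈ ha≡hb = coding-injective a∈ b∈ (cong proj₁ ha≡hb) (cong proj₂ ha≡hb)
    unique-h[P] : Unique (map h P)
    unique-h[P] = Unique-map⁺-injectiveOn h h-injective uP
    h[P]⊆C×S : map h P ⊆ cartesianProduct C S
    h[P]⊆C×S ha∈ with ∈-map⁻ h ha∈
    ... | a , a∈ , refl = ∈-cartesianProduct⁺ (code∈C a∈) (F∈S a∈)

  ^ℚ-nonNeg : ∀ {φ} → 0ℚ ℚ.≤ φ → ∀ k → 0ℚ ℚ.≤ φ ^ℚ k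
  ^ℚ-nonNeg φ≥0 zero        = ℚₚ.nonNegative⁻¹ 1ℚ
  ^ℚ-nonNeg {φ} φ≥0 (suc k) = begin
    0ℚ           ≡⟨ sym (ℚₚ.*-zeroʳ φ) ⟩
    φ ℚ.* 0ℚ     ≤⟨ ℚₚ.*-monoˡ-≤-nonNeg φ {{ℚ.nonNegative φ≥0}} (^ℚ-nonNeg φ≥0 k) ⟩
    φ ℚ.* φ ^ℚ k ∎
    where open ℚₚ.≤-Reasoning

  ^ℚ-≤1 : ∀ {φ} → 0ℚ ℚ.≤ φ → φ ℚ.≤ 1ℚ → ∀ k → φ ^ℚ k ℚ.≤ 1ℚ
  ^ℚ-≤1 φ≥0 φ≤1 zero        = ℚₚ.≤-refl
  ^ℚ-≤1 {φ} φ≥0 φ≤1 (suc k) = begin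
    φ ℚ.* φ ^ℚ k ≤⟨ ℚₚ.*-monoˡ-≤-nonNeg φ {{ℚ.nonNegative φ≥0}} (^ℚ-≤1 φ≥0 φ≤1 k) ⟩
    φ ℚ.* 1ℚ     ≡⟨ ℚₚ.*-identityʳ φ ⟩
    φ            ≤⟨ φ≤1 ⟩
    1ℚ           ∎
    where open ℚₚ.≤-Reasoning

  ^ℚ-antitone : ∀ {φ} → 0ℚ ℚ.≤ φ → φ ℚ.≤ 1ℚ → ∀ {a b} → a ≤ b → φ ^ℚ b ℚ.≤ φ ^ℚ a
  ^ℚ-antitone φ≥0 φ≤1 {b = b} z≤n     = ^ℚ-≤1 φ≥0 φ≤1 b
  ^ℚ-antitone {φ} φ≥0 φ≤1 (s≤s a≤b) = ℚₚ.*-monoˡ-≤-nonNeg φ {{ℚ.nonNegative φ≥0}} (^ℚ-antitone φ≥0 φ≤1 a≤b)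

  -- Permutations as lists

  ∈-insertEverywhere⁻ : ∀ {A : Set} (x : A) σ {ρ} → ρ ∈ insertEverywhere x σ → ρ ↭ x ∷ σ
  ∈-insertEverywhere⁻ x []       (here refl) = ↭-refl
  ∈-insertEverywhere⁻ x (y ∷ σ)  (here refl) = ↭-refl
  ∈-insertEverywhere⁻ x (y ∷ σ)  (there ρ∈) with ∈-map⁻ (y ∷_) ρ∈
  ... | ρ′ , ρ′∈ , refl = ↭-trans (prep y (∈-insertEverywhere⁻ x σ ρ′∈)) (swap y x ↭-refl)

  ∈-insertEverywhere⁺ : ∀ {A : Set} (x : A) αs βs → αs ++ x ∷ βs ∈ insertEverywhere x (αs ++ βs)
  ∈-insertEverywhere⁺ x []       []       = here refl
  ∈-insertEverywhere⁺ x []       (β ∷ βs) = here refl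
  ∈-insertEverywhere⁺ x (α ∷ αs) βs       = there (∈-map⁺ (α ∷_) (∈-insertEverywhere⁺ x αs βs))

  ∈-perms⁻ : ∀ {A : Set} (xs : List A) {ρ} → ρ ∈ perms xs → ρ ↭ xs
  ∈-perms⁻ []       (here refl) = ↭-refl
  ∈-perms⁻ (x ∷ xs) ρ∈ with find (∈-concatMap⁻ (insertEverywhere x) {xs = perms xs} ρ∈)
  ... | σ , σ∈ , ρ∈ins = ↭-trans (∈-insertEverywhere⁻ x σ ρ∈ins) (prep x (∈-perms⁻ xs σ∈))

  ∈-perms⁺ : ∀ {A : Set} (xs : List A) {ρ} → ρ ↭ xs → ρ ∈ perms xs
  ∈-perms⁺ []       ρ↭ rewrite ↭-empty-inv ρ↭ = here refl
  ∈-perms⁺ (x ∷ xs) ρ↭ with ∈-∃++ (∈-resp-↭ (↭-sym ρ↭) (here refl))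
  ... | αs , βs , refl = ∈-concatMap⁺ (insertEverywhere x) {xs = perms xs}
                           (lose (∈-perms⁺ xs (drop-mid αs [] ρ↭)) (∈-insertEverywhere⁺ x αs βs))

  remove : ℕ → List ℕ → List ℕ
  remove x = filter (λ y → ¬? (x ≟ y))

  remove-insertEverywhere : ∀ {x σ ρ} → x ∉ σ → ρ ∈ insertEverywhere x σ → remove x ρ ≡ σ
  remove-insertEverywhere {x} {[]}    x∉σ (here refl) = filter-reject (λ y → ¬? (x ≟ y)) (λ x≢x → x≢x refl)
  remove-insertEverywhere {x} {y ∷ σ} x∉σ (here refl) =
    trans (filter-reject (λ y → ¬? (x ≟ y)) (λ x≢x → x≢x refl)) (filter-all (λ y → ¬? (x ≟ y)) (All.¬Any⇒All¬ _ x∉σ))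
  remove-insertEverywhere {x} {y ∷ σ} x∉σ (there ρ∈) with ∈-map⁻ (y ∷_) ρ∈
  ... | ρ′ , ρ′∈ , refl = trans (filter-accept (λ y → ¬? (x ≟ y)) (λ x≡y → x∉σ (here x≡y)))
                                (cong (y ∷_) (remove-insertEverywhere (x∉σ ∘ there) ρ′∈))

  Unique-insertEverywhere : ∀ {A : Set} {x : A} {σ} → x ∉ σ → Unique (insertEverywhere x σ)
  Unique-insertEverywhere {σ = []}    _   = [] ∷ []
  Unique-insertEverywhere {x = x} {y ∷ σ} x∉σ =
    All.¬Any⇒All¬ _ head∉ ∷ Unique.map⁺ ∷-injectiveʳ (Unique-insertEverywhere (x∉σ ∘ there))
    where
    head∉ : x ∷ y ∷ σ ∉ map (y ∷_) (insertEverywhere x σ)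
    head∉ ∈map with ∈-map⁻ (y ∷_) ∈map
    ... | _ , _ , refl = x∉σ (here refl)

  Unique-perms : ∀ {xs : List ℕ} → Unique xs → Unique (perms xs)
  Unique-perms {[]}     _           = [] ∷ []
  Unique-perms {x ∷ xs} (x∉ ∷ uxs) = Unique-insertions (perms xs) (Unique-perms uxs) (λ σ∈ → σ∈)
    where
    x∉perm : ∀ {σ} → σ ∈ perms xs → x ∉ σ
    x∉perm σ∈ x∈σ = All.All¬⇒¬Any x∉ (∈-resp-↭ (∈-perms⁻ xs σ∈) x∈σ)
    Unique-insertions : ∀ Σs → Unique Σs → Σs ⊆ perms xs → Unique (concatMap (insertEverywhere x) Σs)
    Unique-insertions []       _           _    = []
    Unique-insertions (σ ∷ Σs) (σ∉ ∷ uΣs) Σs⊆ =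
      Unique.++⁺ (Unique-insertEverywhere (x∉perm (Σs⊆ (here refl)))) (Unique-insertions Σs uΣs (Σs⊆ ∘ there)) disjoint
      where
      disjoint : ∀ {ρ} → ¬ (ρ ∈ insertEverywhere x σ × ρ ∈ concatMap (insertEverywhere x) Σs)
      disjoint (ρ∈σ , ρ∈Σs) with find (∈-concatMap⁻ (insertEverywhere x) {xs = Σs} ρ∈Σs)
      ... | σ′ , σ′∈ , ρ∈σ′ = All.All¬⇒¬Any σ∉ (subst (_∈ Σs)
            (trans (sym (remove-insertEverywhere (x∉perm (Σs⊆ (there σ′∈))) ρ∈σ′))
                   (remove-insertEverywhere (x∉perm (Σs⊆ (here refl))) ρ∈σ)) σ′∈)

  pos-head : ∀ x π → pos (x ∷ π) x ≡ 0
  pos-head x π = cong (λ b → if b then 0 else suc (pos π x)) (dec-true (x ≟ x) refl)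

  pos-tail : ∀ {x y} π → y ≢ x → pos (y ∷ π) x ≡ suc (pos π x)
  pos-tail {x} {y} π y≢x = cong (λ b → if b then 0 else suc (pos π x)) (dec-false (y ≟ x) y≢x)

  pos≤length : ∀ π x → pos π x ≤ length π
  pos≤length []      x = z≤n
  pos≤length (y ∷ π) x with y ≟ x
  ... | yes refl = subst (_≤ suc (length π)) (sym (pos-head x π)) z≤n
  ... | no  y≢x  = subst (_≤ suc (length π)) (sym (pos-tail π y≢x)) (s≤s (pos≤length π x))

  pos<length : ∀ {π x} → x ∈ π → pos π x < length π
  pos<length {x ∷ π} (here refl) = subst (_< suc (length π)) (sym (pos-head x π)) z<s
  pos<length {y ∷ π} {x} (there x∈π) with y ≟ x
  ... | yes refl = subst (_< suc (length π)) (sym (pos-head x π)) z<s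
  ... | no  y≢x  = subst (_< suc (length π)) (sym (pos-tail π y≢x)) (s≤s (pos<length x∈π))

  pos-∉ : ∀ {π x} → x ∉ π → pos π x ≡ length π
  pos-∉ {[]}    x∉π = refl
  pos-∉ {y ∷ π} x∉π = trans (pos-tail π (λ y≡x → x∉π (here (sym y≡x)))) (cong suc (pos-∉ (x∉π ∘ there)))

  pos-++ʳ : ∀ {x} π ρ → x ∉ π → pos (π ++ ρ) x ≡ length π + pos ρ x
  pos-++ʳ []      ρ x∉π = refl
  pos-++ʳ (y ∷ π) ρ x∉π =
    trans (pos-tail (π ++ ρ) (λ y≡x → x∉π (here (sym y≡x)))) (cong suc (pos-++ʳ π ρ (x∉π ∘ there)))

  pos-++ˡ : ∀ {x} π ρ → x ∈ π → pos (π ++ ρ) x ≡ pos π x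
  pos-++ˡ (x ∷ π) ρ (here refl) = trans (pos-head x (π ++ ρ)) (sym (pos-head x π))
  pos-++ˡ {x} (y ∷ π) ρ (there x∈π) with y ≟ x
  ... | yes refl = trans (pos-head x (π ++ ρ)) (sym (pos-head x π))
  ... | no  y≢x  = trans (pos-tail (π ++ ρ) y≢x) (trans (cong suc (pos-++ˡ π ρ x∈π)) (sym (pos-tail π y≢x)))

  pos≡0⇒head : ∀ {x y} π → pos (y ∷ π) x ≡ 0 → y ≡ x
  pos≡0⇒head {x} {y} π pos≡0 with y ≟ x
  ... | yes y≡x = y≡x
  ... | no  y≢x = contradiction (trans (sym (pos-tail π y≢x)) pos≡0) 1+n≢0

  pos-injective : ∀ {π x y} → x ∈ π → pos π x ≡ pos π y → x ≡ y
  pos-injective {z ∷ π} {x} {y} x∈π eq with z ≟ x | z ≟ y | x∈π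
  ... | yes refl | yes refl | _         = refl
  ... | yes refl | no z≢y   | _         = contradiction (trans (sym (pos-head x π)) (trans eq (pos-tail π z≢y))) 0≢1+n
  ... | no z≢x   | yes refl | _         = contradiction (trans (sym (pos-head y π)) (trans (sym eq) (pos-tail π z≢x))) 0≢1+n
  ... | no z≢x   | no _     | here refl = contradiction refl z≢x
  ... | no z≢x   | no z≢y   | there x∈ =
    pos-injective x∈ (suc-injective (trans (sym (pos-tail π z≢x)) (trans eq (pos-tail π z≢y))))

  pos-increasing : ∀ {π} → Unique π → AllPairs (λ x y → pos π x < pos π y) π
  pos-increasing {[]}    []           = []
  pos-increasing {p ∷ π} (p∉ ∷ uπ) =
    All.map (λ p≢y → subst₂ _<_ (sym (pos-head p π)) (sym (pos-tail π p≢y)) z<s) p∉ ∷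
    AllPairs-mapWith (λ p≢x p≢y x<y → subst₂ _<_ (sym (pos-tail π p≢x)) (sym (pos-tail π p≢y)) (s≤s x<y))
                     p∉ (pos-increasing uπ)

  filter-pos-injective : ∀ {P : Pred ℕ 0ℓ} (P? : Decidable P) {π₁ π₂} → length π₁ ≡ length π₂ →
                         Unique π₁ → Unique π₂ → filter (∁? P?) π₁ ≡ filter (∁? P?) π₂ →
                         (∀ {x} → P x → pos π₁ x ≡ pos π₂ x) → π₁ ≡ π₂
  filter-pos-injective P? {[]} {[]} _ _ _ _ _ = refl
  filter-pos-injective {P} P? {a ∷ π₁} {b ∷ π₂} |π₁|≡|π₂| u₁@(_ ∷ uπ₁) u₂@(_ ∷ uπ₂) free≡ pos≡ = by-cases (P? a) (P? b)
    where
    tails≡ : filter (∁? P?) π₁ ≡ filter (∁? P?) π₂ → (∀ {x} → P x → pos π₁ x ≡ pos π₂ x) → π₁ ≡ π₂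
    tails≡ = filter-pos-injective P? (suc-injective |π₁|≡|π₂|) uπ₁ uπ₂
    by-cases : Dec (P a) → Dec (P b) → a ∷ π₁ ≡ b ∷ π₂
    by-cases (yes Pa) _ = cong₂ _∷_ (sym b≡a) (tails≡ tail-free≡ tail-pos≡)
      where
      b≡a : b ≡ a
      b≡a = pos≡0⇒head π₂ (trans (sym (pos≡ Pa)) (pos-head a π₁))
      tail-free≡ : filter (∁? P?) π₁ ≡ filter (∁? P?) π₂
      tail-free≡ = trans (sym (filter-reject (∁? P?) (λ ¬Pa → ¬Pa Pa)))
                         (trans free≡ (filter-reject (∁? P?) (λ ¬Pb → ¬Pb (subst P (sym b≡a) Pa))))
      tail-pos≡ : ∀ {x} → P x → pos π₁ x ≡ pos π₂ x
      tail-pos≡ {x} Px with a ≟ x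
      ... | yes refl = trans (pos-∉ (Unique.Unique[x∷xs]⇒x∉xs u₁))
                         (trans (suc-injective |π₁|≡|π₂|) (sym (pos-∉ (subst (_∉ π₂) b≡a (Unique.Unique[x∷xs]⇒x∉xs u₂)))))
      ... | no  a≢x  = suc-injective (trans (sym (pos-tail π₁ a≢x)) (trans (pos≡ Px) (pos-tail π₂ (a≢x ∘ trans (sym b≡a)))))
    by-cases (no ¬Pa) (yes Pb) = contradiction (subst P (sym a≡b) Pb) ¬Pa
      where
      a≡b : a ≡ b
      a≡b = pos≡0⇒head π₁ (trans (pos≡ Pb) (pos-head b π₂))
    by-cases (no ¬Pa) (no ¬Pb) = cong₂ _∷_ (proj₁ heads-tails) (tails≡ (proj₂ heads-tails) tail-pos≡)
      where
      heads-tails = ∷-injective (trans (sym (filter-accept (∁? P?) ¬Pa)) (trans free≡ (filter-accept (∁? P?) ¬Pb)))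
      tail-pos≡ : ∀ {x} → P x → pos π₁ x ≡ pos π₂ x
      tail-pos≡ Px = suc-injective (trans (sym (pos-tail π₁ (λ a≡x → ¬Pa (subst P (sym a≡x) Px))))
                       (trans (pos≡ Px) (pos-tail π₂ (λ b≡x → ¬Pb (subst P (sym b≡x) Px)))))

  tuples : ℕ → ℕ → List (List ℕ)
  tuples zero    n = [] ∷ []
  tuples (suc l) n = cartesianProductWith _∷_ (upTo n) (tuples l n)

  length-tuples : ∀ l n → length (tuples l n) ≡ n ^ l
  length-tuples zero    n = refl
  length-tuples (suc l) n = trans (length-cartesianProductWith _∷_ (upTo n) (tuples l n))
                                  (cong₂ _*_ (length-upTo n) (length-tuples l n))

  ∈-tuples : ∀ {n} c → All (_< n) c → c ∈ tuples (length c) n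
  ∈-tuples []      []          = here refl
  ∈-tuples (x ∷ c) (x<n ∷ c<n) = ∈-cartesianProductWith⁺ _∷_ (∈-upTo⁺ x<n) (∈-tuples c c<n)

  -- Block structures

  all⁺ : ∀ {A : Set} (p : A → Bool) {xs} → All (T ∘ p) xs → T (all p xs)
  all⁺ p []         = _
  all⁺ p (px ∷ pxs) = from T-∧ (px , all⁺ p pxs)

  all⁻ : ∀ {A : Set} (p : A → Bool) xs → T (all p xs) → All (T ∘ p) xs
  all⁻ p []       _ = []
  all⁻ p (x ∷ xs) t = proj₁ (to T-∧ t) ∷ all⁻ p xs (proj₂ (to T-∧ t))

  any⁺ : ∀ {A : Set} (p : A → Bool) {xs} → Any (T ∘ p) xs → T (any p xs)
  any⁺ p {x ∷ _} (here px)  with p x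
  ... | true = _
  any⁺ p {x ∷ _} (there pxs) with p x
  ... | true  = _
  ... | false = any⁺ p pxs

  any⁻ : ∀ {A : Set} (p : A → Bool) xs → T (any p xs) → Any (T ∘ p) xs
  any⁻ p (x ∷ xs) t with p x in eq
  ... | true  = here (from T-≡ eq)
  ... | false = there (any⁻ p xs t)

  Consecutive : List ℕ → List ℕ → Set
  Consecutive π S = ∃[ a ] All (λ x → a ≤ pos π x × pos π x < a + length S) S

  Precedes : (ℕ → ℕ) → List ℕ → List ℕ → Set
  Precedes r S S′ = All (λ x → All (λ y → r x < r y) S′) S

  Satisfies : List ℕ → BlockStructure → Set
  Satisfies π B = All (Consecutive π) B × AllPairs (Precedes (pos π)) B

  consecutive⁻ : ∀ π S → T (consecutive π S) → Consecutive π S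
  consecutive⁻ π S t with Any.satisfied (any⁻ _ (upTo (suc (length π))) t)
  ... | a , ta = a , All.map (λ {x} t′ → let (t₁ , t₂) = to T-∧ t′ in ≤ᵇ⇒≤ a (pos π x) t₁ , <ᵇ⇒< _ _ t₂)
                             (all⁻ _ S ta)

  consecutive⁺ : ∀ π S → Consecutive π S → T (consecutive π S)
  consecutive⁺ π []        _                 = _
  consecutive⁺ π S@(x ∷ _) (a , h@((a≤x , _) ∷ _)) =
    any⁺ _ (lose (∈-upTo⁺ (s≤s (≤-trans a≤x (pos≤length π x))))
                 (all⁺ _ (All.map (λ (a≤ , <a+) → from T-∧ (≤⇒≤ᵇ a≤ , <⇒<ᵇ <a+)) h)))

  before⁻ : ∀ π S S′ → T (before π S S′) → Precedes (pos π) S S′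
  before⁻ π S S′ t = All.map (λ t′ → All.map (<ᵇ⇒< _ _) (all⁻ _ S′ t′)) (all⁻ _ S t)

  before⁺ : ∀ π S S′ → Precedes (pos π) S S′ → T (before π S S′)
  before⁺ π S S′ h = all⁺ _ (All.map (λ h′ → all⁺ _ (All.map <⇒<ᵇ h′)) h)

  inOrder⁻ : ∀ π B → T (inOrder π B) → AllPairs (Precedes (pos π)) B
  inOrder⁻ π []      _ = []
  inOrder⁻ π (S ∷ B) t = let (t₁ , t₂) = to T-∧ t in
    All.map (before⁻ π S _) (all⁻ _ B t₁) ∷ inOrder⁻ π B t₂

  inOrder⁺ : ∀ π B → AllPairs (Precedes (pos π)) B → T (inOrder π B)
  inOrder⁺ π []      []       = _
  inOrder⁺ π (S ∷ B) (h ∷ hs) = from T-∧ (all⁺ _ (All.map (before⁺ π S _) h) , inOrder⁺ π B hs)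

  satisfies⁻ : ∀ π B → T (satisfies π B) → Satisfies π B
  satisfies⁻ π B t = let (t₁ , t₂) = to T-∧ t in All.map (consecutive⁻ π _) (all⁻ _ B t₁) , inOrder⁻ π B t₂

  satisfies⁺ : ∀ π B → Satisfies π B → T (satisfies π B)
  satisfies⁺ π B (c , o) = from T-∧ (all⁺ _ (All.map (consecutive⁺ π _) c) , inOrder⁺ π B o)

  Satisfies-++ˡ : ∀ P {R B} → All (All (_∉ P)) B → Satisfies R B → Satisfies (P ++ R) B
  Satisfies-++ˡ P {R} {B} ∉P (cs , os) =
    All.zipWith (λ (S∉P , c) → shiftBlock S∉P c) (∉P , cs) , AllPairs-mapWith shiftOrder ∉P os
    where
    pos-shift : ∀ {x} → x ∉ P → pos (P ++ R) x ≡ length P + pos R x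
    pos-shift = pos-++ʳ P R
    shiftBlock : ∀ {S} → All (_∉ P) S → Consecutive R S → Consecutive (P ++ R) S
    shiftBlock {S} S∉P (a , h) = length P + a , All.zipWith
      (λ (x∉P , a≤ , <a+) →
         subst (length P + a ≤_) (sym (pos-shift x∉P)) (+-monoʳ-≤ (length P) a≤) ,
         subst₂ _<_ (sym (pos-shift x∉P)) (sym (+-assoc (length P) a (length S))) (+-monoʳ-< (length P) <a+))
      (S∉P , h)
    shiftOrder : ∀ {S S′} → All (_∉ P) S → All (_∉ P) S′ → Precedes (pos R) S S′ → Precedes (pos (P ++ R)) S S′
    shiftOrder S∉P S′∉P h = All.zipWith (λ (x∉P , hx) → All.zipWith
      (λ (y∉P , x<y) → subst₂ _<_ (sym (pos-shift x∉P)) (sym (pos-shift y∉P)) (+-monoʳ-< (length P) x<y))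
      (S′∉P , hx)) (S∉P , h)

  Reordering : List ℕ → List ℕ → Set
  Reordering S T = S ⊆ T × T ⊆ S × length T ≡ length S

  Consecutive-++ : ∀ {S T} R → Reordering S T → Consecutive (T ++ R) S
  Consecutive-++ {S} {T} R (S⊆T , _ , |T|≡|S|) = 0 , All.tabulate (λ x∈S →
    z≤n , subst₂ _<_ (sym (pos-++ˡ T R (S⊆T x∈S))) |T|≡|S| (pos<length (S⊆T x∈S)))

  Precedes-++ : ∀ {S T S′} R → Reordering S T → All (_∉ T) S′ → Precedes (pos (T ++ R)) S S′
  Precedes-++ {S} {T} R (S⊆T , _ , _) ∉T = All.tabulate (λ {x} x∈S → All.map (λ {y} y∉T → begin-strict
    pos (T ++ R) x      ≡⟨ pos-++ˡ T R (S⊆T x∈S) ⟩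
    pos T x             <⟨ pos<length (S⊆T x∈S) ⟩
    length T            ≤⟨ m≤m+n (length T) (pos R y) ⟩
    length T + pos R y  ≡⟨ sym (pos-++ʳ T R y∉T) ⟩
    pos (T ++ R) y      ∎) ∉T)
    where open ≤-Reasoning

  Precedes-⊆ : ∀ {r S S′ T T′} → T ⊆ S → T′ ⊆ S′ → Precedes r S S′ → Precedes r T T′
  Precedes-⊆ T⊆S T′⊆S′ h = All.tabulate (λ x∈T → All.tabulate (λ y∈T′ → All.lookup (All.lookup h (T⊆S x∈T)) (T′⊆S′ y∈T′)))

  Consecutive-convex : ∀ {π S a x y} → Unique S → S ⊆ π → Consecutive π S → a ∈ π → a ∉ S → x ∈ S → y ∈ S →
                       ¬ (pos π x < pos π a × pos π a < pos π y)
  Consecutive-convex {π} {S} {a} uS S⊆π (c , inWindow) a∈π a∉S x∈S y∈S (x<a , a<y) = 1+n≰n (begin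
    suc (length S)                          ≡⟨ cong suc (sym (length-map (pos π) S)) ⟩
    length positions                        ≤⟨ Unique-⊆⇒length≤ unique-positions positions⊆window ⟩
    length (applyUpTo (c +_) (length S))    ≡⟨ List.length-applyUpTo (c +_) (length S) ⟩
    length S                                ∎)
    where
    open ≤-Reasoning
    positions = pos π a ∷ map (pos π) S
    unique-positions : Unique positions
    unique-positions =
      All.map⁺ (All.tabulate (λ z∈S pa≡pz → a∉S (subst (_∈ S) (sym (pos-injective a∈π pa≡pz)) z∈S))) ∷
      Unique-map⁺-injectiveOn (pos π) (λ s∈S _ → pos-injective (S⊆π s∈S)) uS
    positions⊆window : positions ⊆ applyUpTo (c +_) (length S)
    positions⊆window (here refl) =
      ∈-window (≤-trans (proj₁ (All.lookup inWindow x∈S)) (<⇒≤ x<a)) (<-trans a<y (proj₂ (All.lookup inWindow y∈S)))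
    positions⊆window (there p∈) with ∈-map⁻ (pos π) p∈
    ... | s , s∈S , refl = uncurry ∈-window (All.lookup inWindow s∈S)

  -- Inversions and insertion costs

  module Inversions (r : ℕ → ℕ) where

    below above : ℕ → List ℕ → ℕ
    below x l = length (filter (λ y → r y <? r x) l)
    above x l = length (filter (λ y → r x <? r y) l)

    inv : List ℕ → ℕ
    inv []      = 0
    inv (x ∷ l) = below x l + inv l

    [_≺_] : ℕ → ℕ → ℕ
    [ a ≺ b ] = if r a <ᵇ r b then 1 else 0

    ≺-yes : ∀ {a b} → r a < r b → [ a ≺ b ] ≡ 1
    ≺-yes ra<rb = cong (λ t → if t then 1 else 0) (dec-true (r _ <? r _) ra<rb)

    ≺-no : ∀ {a b} → ¬ r a < r b → [ a ≺ b ] ≡ 0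
    ≺-no ra≮rb = cong (λ t → if t then 1 else 0) (dec-false (r _ <? r _) ra≮rb)

    below-∷ : ∀ x a l → below x (a ∷ l) ≡ [ a ≺ x ] + below x l
    below-∷ x a l with r a <ᵇ r x
    ... | true  = refl
    ... | false = refl

    above-∷ : ∀ x a l → above x (a ∷ l) ≡ [ x ≺ a ] + above x l
    above-∷ x a l with r x <ᵇ r a
    ... | true  = refl
    ... | false = refl

    cost : ℕ → List ℕ → ℕ → ℕ
    cost x u g = above x (take g u) + below x (drop g u)

    cost-[] : ∀ x g → cost x [] g ≡ 0
    cost-[] x zero    = refl
    cost-[] x (suc g) = refl

    cost-suc : ∀ x a u g → cost x (a ∷ u) (suc g) ≡ [ x ≺ a ] + cost x u g
    cost-suc x a u g = trans (cong (_+ below x (drop g u)) (above-∷ x a (take g u))) (+-assoc [ x ≺ a ] _ _)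

    cost-zero : ∀ x a u → cost x (a ∷ u) 0 ≡ [ a ≺ x ] + cost x u 0
    cost-zero x a u = below-∷ x a u

    ≺-monge : ∀ {x y} → r x < r y → ∀ a → [ y ≺ a ] + [ a ≺ x ] ≤ [ a ≺ y ] + [ x ≺ a ]
    ≺-monge {x} {y} rx<ry a with r y <? r a | r a <? r x
    ... | yes ry<ra | yes ra<rx = contradiction (<-trans ra<rx (<-trans rx<ry ry<ra)) (<-irrefl refl)
    ... | yes ry<ra | no  ra≮rx rewrite ≺-yes ry<ra | ≺-no ra≮rx | ≺-yes (<-trans rx<ry ry<ra) = m≤n+m 1 [ a ≺ y ]
    ... | no  ry≮ra | yes ra<rx rewrite ≺-no ry≮ra | ≺-yes ra<rx | ≺-yes (<-trans ra<rx rx<ry) = s≤s z≤n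
    ... | no  ry≮ra | no  ra≮rx rewrite ≺-no ry≮ra | ≺-no ra≮rx = z≤n

    cost-monge : ∀ {x y} → r x < r y → ∀ u {g′ g} → g′ ≤ g → cost y u g + cost x u g′ ≤ cost y u g′ + cost x u g
    cost-monge {x} {y} _ [] {g′} {g} _
      rewrite cost-[] x g | cost-[] x g′ | cost-[] y g | cost-[] y g′ = z≤n
    cost-monge rx<ry (a ∷ u) {zero}   {zero}   _ = ≤-refl
    cost-monge {x} {y} rx<ry (a ∷ u) {zero} {suc g} _
      rewrite cost-suc y a u g | cost-zero x a u | cost-zero y a u | cost-suc x a u g =
      +-mono-≤-interchange {[ y ≺ a ]} {[ a ≺ x ]} {[ a ≺ y ]} {[ x ≺ a ]}
                           {cost y u g} {cost x u 0} {cost y u 0} {cost x u g}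
                           (≺-monge rx<ry a) (cost-monge rx<ry u (z≤n {g}))
    cost-monge {x} {y} rx<ry (a ∷ u) {suc g′} {suc g} (s≤s g′≤g)
      rewrite cost-suc y a u g | cost-suc x a u g′ | cost-suc y a u g′ | cost-suc x a u g =
      +-mono-≤-interchange {[ y ≺ a ]} {[ x ≺ a ]} {[ y ≺ a ]} {[ x ≺ a ]}
                           {cost y u g} {cost x u g′} {cost y u g′} {cost x u g}
                           ≤-refl (cost-monge rx<ry u g′≤g)

    bestGap : ℕ → List ℕ → ℕ
    bestGap x u = argmin (cost x u) (length u)

    bestGap-≤ : ∀ x u → bestGap x u ≤ length u
    bestGap-≤ x u = argmin-≤ (cost x u) (length u)

    cost-beyond : ∀ x u {g} → length u ≤ g → cost x u g ≡ cost x u (length u)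
    cost-beyond x u {g} u≤g
      rewrite List.take-all g u u≤g | List.drop-all g u u≤g
            | List.take-all (length u) u ≤-refl | List.drop-all (length u) u ≤-refl = refl

    cost-bestGap : ∀ x u g → cost x u (bestGap x u) ≤ cost x u g
    cost-bestGap x u g with g ≤? length u
    ... | yes g≤u = argmin-minimal (cost x u) g≤u
    ... | no  g≰u rewrite cost-beyond x u (<⇒≤ (≰⇒> g≰u)) = argmin-minimal (cost x u) (≤-refl {length u})

    bestGap-mono : ∀ {x y} → r x < r y → ∀ u → bestGap x u ≤ bestGap y u
    bestGap-mono {x} {y} rx<ry u = argmin-mono (cost x u) (cost y u) (length u) (cost-monge rx<ry u)

    cost-cong : ∀ {x y} u → All (λ a → (r x < r a ⇔ r y < r a) × (r a < r x ⇔ r a < r y)) u →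
                ∀ g → cost x u g ≡ cost y u g
    cost-cong u sameSide g = cong₂ _+_
      (cong length (filter-cong-All _ _ (All.take⁺ g (All.map proj₁ sameSide))))
      (cong length (filter-cong-All _ _ (All.drop⁺ g (All.map proj₂ sameSide))))

    below-≡0 : ∀ {x} l → All (λ y → r x < r y) l → below x l ≡ 0
    below-≡0 []      []            = refl
    below-≡0 {x} (y ∷ l) (rx<ry ∷ h) = trans (below-∷ x y l) (cong₂ _+_ (≺-no (<⇒≯ rx<ry)) (below-≡0 l h))

    inv-increasing : ∀ {l} → AllPairs (λ x y → r x < r y) l → inv l ≡ 0
    inv-increasing {[]}    []      = refl
    inv-increasing {x ∷ l} (h ∷ hs) = cong₂ _+_ (below-≡0 l h) (inv-increasing hs)

    module Split {P : Pred ℕ 0ℓ} (P? : Decidable P) where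

      freePart blockPart : List ℕ → List ℕ
      freePart  = filter (∁? P?)
      blockPart = filter P?

      gaps : List ℕ → List (ℕ × ℕ)
      gaps []      = []
      gaps (y ∷ l) with P? y
      ... | yes _ = (y , 0) ∷ gaps l
      ... | no  _ = map (map₂ suc) (gaps l)

      crossCost : List ℕ → List (ℕ × ℕ) → ℕ
      crossCost u gs = sum (map (λ (x , g) → cost x u g) gs)

      cross : List ℕ → ℕ
      cross l = crossCost (freePart l) (gaps l)

      proj₁-gaps : ∀ l → map proj₁ (gaps l) ≡ blockPart l
      proj₁-gaps []      = refl
      proj₁-gaps (y ∷ l) with P? y
      ... | yes _ = cong (y ∷_) (proj₁-gaps l)
      ... | no  _ = trans (sym (List.map-∘ (gaps l))) (proj₁-gaps l)

      below-split : ∀ y l → below y l ≡ below y (freePart l) + below y (blockPart l)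
      below-split y []      = refl
      below-split y (x ∷ l) with P? x
      ... | yes _ = begin
        below y (x ∷ l)                                            ≡⟨ below-∷ y x l ⟩
        [ x ≺ y ] + below y l                                      ≡⟨ cong ([ x ≺ y ] +_) (below-split y l) ⟩
        [ x ≺ y ] + (below y (freePart l) + below y (blockPart l)) ≡⟨ x∙yz≈y∙xz [ x ≺ y ] (below y (freePart l)) _ ⟩
        below y (freePart l) + ([ x ≺ y ] + below y (blockPart l)) ≡⟨ cong (below y (freePart l) +_) (sym (below-∷ y x _)) ⟩
        below y (freePart l) + below y (x ∷ blockPart l)           ∎
        where open ≡-Reasoning
      ... | no  _ = begin
        below y (x ∷ l)                                            ≡⟨ below-∷ y x l ⟩
        [ x ≺ y ] + below y l                                      ≡⟨ cong ([ x ≺ y ] +_) (below-split y l) ⟩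
        [ x ≺ y ] + (below y (freePart l) + below y (blockPart l)) ≡⟨ sym (+-assoc [ x ≺ y ] _ _) ⟩
        ([ x ≺ y ] + below y (freePart l)) + below y (blockPart l) ≡⟨ cong (_+ below y (blockPart l)) (sym (below-∷ y x _)) ⟩
        below y (x ∷ freePart l) + below y (blockPart l)           ∎
        where open ≡-Reasoning

      crossCost-shift : ∀ y u gs → crossCost (y ∷ u) (map (map₂ suc) gs) ≡ below y (map proj₁ gs) + crossCost u gs
      crossCost-shift y u []             = refl
      crossCost-shift y u ((x , g) ∷ gs) = begin
        cost x (y ∷ u) (suc g) + crossCost (y ∷ u) (map (map₂ suc) gs)
          ≡⟨ cong₂ _+_ (cost-suc x y u g) (crossCost-shift y u gs) ⟩
        ([ x ≺ y ] + cost x u g) + (below y (map proj₁ gs) + crossCost u gs)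
          ≡⟨ interchange [ x ≺ y ] (cost x u g) (below y (map proj₁ gs)) (crossCost u gs) ⟩
        ([ x ≺ y ] + below y (map proj₁ gs)) + (cost x u g + crossCost u gs)
          ≡⟨ cong (_+ (cost x u g + crossCost u gs)) (sym (below-∷ y x (map proj₁ gs))) ⟩
        below y (x ∷ map proj₁ gs) + (cost x u g + crossCost u gs)
          ∎
        where open ≡-Reasoning

      inv-split : ∀ l → inv l ≡ inv (freePart l) + inv (blockPart l) + cross l
      inv-split []      = refl
      inv-split (y ∷ l) with P? y
      ... | yes _ rewrite below-split y l | inv-split l =
        solve 5 (λ a b c d e → (a :+ b) :+ (c :+ d :+ e) := c :+ (b :+ d) :+ (a :+ e)) refl
          (below y (freePart l)) (below y (blockPart l)) (inv (freePart l)) (inv (blockPart l)) (cross l)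
        where open +-*-Solver
      ... | no  _ rewrite crossCost-shift y (freePart l) (gaps l) | proj₁-gaps l | below-split y l | inv-split l =
        solve 5 (λ a b c d e → (a :+ b) :+ (c :+ d :+ e) := (a :+ c) :+ d :+ (b :+ e)) refl
          (below y (freePart l)) (below y (blockPart l)) (inv (freePart l)) (inv (blockPart l)) (cross l)
        where open +-*-Solver

      module Insert (u₀ : List ℕ) where

        gap : ℕ → ℕ
        gap x = bestGap x u₀

        -- k counts the free elements already emitted, v holds the remaining ones.
        insertBlocks : ℕ → List ℕ → List (List ℕ) → List ℕ
        insertBlocks k v []             = v
        insertBlocks k v ([] ∷ Ts)      = insertBlocks k v Ts
        insertBlocks k v ((x ∷ T) ∷ Ts) = take d v ++ (x ∷ T) ++ insertBlocks (k + d) (drop d v) Ts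
          where d = gap x ∸ k

        freePart-insertBlocks : ∀ k v Ts → All (∁ P) v → All (All P) Ts → freePart (insertBlocks k v Ts) ≡ v
        freePart-insertBlocks k v []             ∁Pv _           = filter-all (∁? P?) ∁Pv
        freePart-insertBlocks k v ([] ∷ Ts)      ∁Pv (_ ∷ PTs)   = freePart-insertBlocks k v Ts ∁Pv PTs
        freePart-insertBlocks k v ((x ∷ T) ∷ Ts) ∁Pv (PxT ∷ PTs) = begin
          freePart (take d v ++ (x ∷ T) ++ R)
            ≡⟨ filter-++ (∁? P?) (take d v) ((x ∷ T) ++ R) ⟩
          freePart (take d v) ++ freePart ((x ∷ T) ++ R)
            ≡⟨ cong₂ _++_ (filter-all (∁? P?) (All.take⁺ d ∁Pv)) (filter-++ (∁? P?) (x ∷ T) R) ⟩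
          take d v ++ freePart (x ∷ T) ++ freePart R
            ≡⟨ cong (take d v ++_) (cong₂ _++_ (filter-none (∁? P?) (All.map (λ Py ¬Py → ¬Py Py) PxT))
                                               (freePart-insertBlocks (k + d) (drop d v) Ts (All.drop⁺ d ∁Pv) PTs)) ⟩
          take d v ++ drop d v
            ≡⟨ take++drop≡id d v ⟩
          v ∎
          where
          open ≡-Reasoning
          d = gap x ∸ k
          R = insertBlocks (k + d) (drop d v) Ts

        blockPart-insertBlocks : ∀ k v Ts → All (∁ P) v → All (All P) Ts → blockPart (insertBlocks k v Ts) ≡ concat Ts
        blockPart-insertBlocks k v []             ∁Pv _           = filter-none P? ∁Pv
        blockPart-insertBlocks k v ([] ∷ Ts)      ∁Pv (_ ∷ PTs)   = blockPart-insertBlocks k v Ts ∁Pv PTs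
        blockPart-insertBlocks k v ((x ∷ T) ∷ Ts) ∁Pv (PxT ∷ PTs) = begin
          blockPart (take d v ++ (x ∷ T) ++ R)
            ≡⟨ filter-++ P? (take d v) ((x ∷ T) ++ R) ⟩
          blockPart (take d v) ++ blockPart ((x ∷ T) ++ R)
            ≡⟨ cong₂ _++_ (filter-none P? (All.take⁺ d ∁Pv)) (filter-++ P? (x ∷ T) R) ⟩
          blockPart (x ∷ T) ++ blockPart R
            ≡⟨ cong₂ _++_ (filter-all P? PxT) (blockPart-insertBlocks (k + d) (drop d v) Ts (All.drop⁺ d ∁Pv) PTs) ⟩
          (x ∷ T) ++ concat Ts ∎
          where
          open ≡-Reasoning
          d = gap x ∸ k
          R = insertBlocks (k + d) (drop d v) Ts

        insertBlocks-↭ : ∀ k v Ts → insertBlocks k v Ts ↭ v ++ concat Ts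
        insertBlocks-↭ k v []             = ↭-reflexive (sym (List.++-identityʳ v))
        insertBlocks-↭ k v ([] ∷ Ts)      = insertBlocks-↭ k v Ts
        insertBlocks-↭ k v ((x ∷ T) ∷ Ts) = begin
          take d v ++ (x ∷ T) ++ R
            ↭⟨ ++⁺ˡ (take d v) (++⁺ˡ (x ∷ T) (insertBlocks-↭ (k + d) (drop d v) Ts)) ⟩
          take d v ++ (x ∷ T) ++ drop d v ++ concat Ts
            ↭⟨ ++⁺ˡ (take d v) (shifts (x ∷ T) (drop d v)) ⟩
          take d v ++ drop d v ++ (x ∷ T) ++ concat Ts
            ≡⟨ sym (++-assoc (take d v) (drop d v) _) ⟩
          (take d v ++ drop d v) ++ (x ∷ T) ++ concat Ts
            ≡⟨ cong (_++ (x ∷ T) ++ concat Ts) (take++drop≡id d v) ⟩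
          v ++ (x ∷ T) ++ concat Ts ∎
          where
          open PermutationReasoning
          d = gap x ∸ k
          R = insertBlocks (k + d) (drop d v) Ts

        gaps-++-free : ∀ {A} M → All (∁ P) A → gaps (A ++ M) ≡ map (map₂ (length A +_)) (gaps M)
        gaps-++-free M []                  = sym (List.map-id (gaps M))
        gaps-++-free {a ∷ A} M (¬Pa ∷ ∁PA) with P? a
        ... | yes Pa = contradiction Pa ¬Pa
        ... | no  _  = trans (cong (map (map₂ suc)) (gaps-++-free M ∁PA)) (sym (List.map-∘ (gaps M)))

        gaps-++-block : ∀ {T} M → All P T → gaps (T ++ M) ≡ map (_, 0) T ++ gaps M
        gaps-++-block M []                 = refl
        gaps-++-block {a ∷ T} M (Pa ∷ PT) with P? a
        ... | no ¬Pa = contradiction Pa ¬Pa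
        ... | yes _  = cong ((a , 0) ∷_) (gaps-++-block M PT)

        gaps-free : ∀ {v} → All (∁ P) v → gaps v ≡ []
        gaps-free {v} ∁Pv = trans (cong gaps (sym (List.++-identityʳ v))) (gaps-++-free [] ∁Pv)

        offsetCost : ℕ → List (ℕ × ℕ) → ℕ
        offsetCost k gs = sum (map (λ (x , g) → cost x u₀ (k + g)) gs)

        offsetCost-shift : ∀ k c gs → offsetCost k (map (map₂ (c +_)) gs) ≡ offsetCost (k + c) gs
        offsetCost-shift k c []             = refl
        offsetCost-shift k c ((x , g) ∷ gs) =
          cong₂ _+_ (cong (cost x u₀) (sym (+-assoc k c g))) (offsetCost-shift k c gs)

        offsetCost-++ : ∀ k gs hs → offsetCost k (gs ++ hs) ≡ offsetCost k gs + offsetCost k hs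
        offsetCost-++ k gs hs = trans (cong sum (map-++ _ gs hs)) (sum-++ (map _ gs) _)

        offsetCost-block : ∀ k T → offsetCost k (map (_, 0) T) ≡ sum (map (λ y → cost y u₀ k) T)
        offsetCost-block k []      = refl
        offsetCost-block k (y ∷ T) = cong₂ _+_ (cong (cost y u₀) (+-identityʳ k)) (offsetCost-block k T)

        SameCost : List ℕ → Set
        SameCost T = ∀ {x y} → x ∈ T → y ∈ T → ∀ g → cost x u₀ g ≡ cost y u₀ g

        bestCost : List ℕ → ℕ
        bestCost T = sum (map (λ y → cost y u₀ (gap y)) T)

        offsetCost-block-≤ : ∀ {x T} → SameCost (x ∷ T) → offsetCost (gap x) (map (_, 0) (x ∷ T)) ≤ bestCost (x ∷ T)
        offsetCost-block-≤ {x} {T} same = begin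
          offsetCost (gap x) (map (_, 0) (x ∷ T))  ≡⟨ offsetCost-block (gap x) (x ∷ T) ⟩
          sum (map (λ y → cost y u₀ (gap x)) (x ∷ T)) ≤⟨ sum-map-mono (x ∷ T) gap-x-optimal ⟩
          bestCost (x ∷ T)                          ∎
          where
          open ≤-Reasoning
          gap-x-optimal : ∀ {y} → y ∈ x ∷ T → cost y u₀ (gap x) ≤ cost y u₀ (gap y)
          gap-x-optimal {y} y∈ = subst₂ _≤_ (same (here refl) y∈ (gap x)) (same (here refl) y∈ (gap y))
                                             (cost-bestGap x u₀ (gap y))

        bestCost≤crossCost : ∀ gs → bestCost (map proj₁ gs) ≤ crossCost u₀ gs
        bestCost≤crossCost []             = z≤n
        bestCost≤crossCost ((x , g) ∷ gs) = +-mono-≤ (cost-bestGap x u₀ g) (bestCost≤crossCost gs)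

        offsetCost-gaps-split : ∀ k {d v T} R → d ≤ length v → All (∁ P) v → All P T →
          offsetCost k (gaps (take d v ++ T ++ R)) ≡ offsetCost (k + d) (map (_, 0) T) + offsetCost (k + d) (gaps R)
        offsetCost-gaps-split k {d} {v} {T} R d≤|v| ∁Pv PT = begin
          offsetCost k (gaps (take d v ++ T ++ R))
            ≡⟨ cong (offsetCost k) (trans (gaps-++-free _ (All.take⁺ d ∁Pv)) (cong (map _) (gaps-++-block R PT))) ⟩
          offsetCost k (map (map₂ (length (take d v) +_)) (map (_, 0) T ++ gaps R))
            ≡⟨ offsetCost-shift k (length (take d v)) (map (_, 0) T ++ gaps R) ⟩
          offsetCost (k + length (take d v)) (map (_, 0) T ++ gaps R)
            ≡⟨ cong (λ c → offsetCost (k + c) (map (_, 0) T ++ gaps R)) (trans (List.length-take d v) (m≤n⇒m⊓n≡m d≤|v|)) ⟩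
          offsetCost (k + d) (map (_, 0) T ++ gaps R)
            ≡⟨ offsetCost-++ (k + d) (map (_, 0) T) (gaps R) ⟩
          offsetCost (k + d) (map (_, 0) T) + offsetCost (k + d) (gaps R)
            ∎
          where open ≡-Reasoning

        offsetCost-insertBlocks : ∀ k v Ts → All (∁ P) v → All (All P) Ts → length u₀ ≤ k + length v →
          All (λ y → k ≤ gap y) (concat Ts) → AllPairs (Precedes r) Ts → All SameCost Ts →
          offsetCost k (gaps (insertBlocks k v Ts)) ≤ bestCost (concat Ts)
        offsetCost-insertBlocks k v [] ∁Pv _ _ _ _ _ rewrite gaps-free ∁Pv = z≤n
        offsetCost-insertBlocks k v ([] ∷ Ts) ∁Pv (_ ∷ PTs) u₀≤ k≤ (_ ∷ ordered) (_ ∷ same) =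
          offsetCost-insertBlocks k v Ts ∁Pv PTs u₀≤ k≤ ordered same
        offsetCost-insertBlocks k v ((x ∷ T) ∷ Ts) ∁Pv (PxT ∷ PTs) u₀≤ (k≤gx ∷ k≤) (x≺Ts ∷ ordered) (sameT ∷ same) = begin
          offsetCost k (gaps (take d v ++ (x ∷ T) ++ R))
            ≡⟨ offsetCost-gaps-split k R d≤|v| ∁Pv PxT ⟩
          offsetCost (k + d) (map (_, 0) (x ∷ T)) + offsetCost (k + d) (gaps R)
            ≡⟨ cong (λ c → offsetCost c (map (_, 0) (x ∷ T)) + offsetCost (k + d) (gaps R)) k+d≡gx ⟩
          offsetCost (gap x) (map (_, 0) (x ∷ T)) + offsetCost (k + d) (gaps R)
            ≤⟨ +-mono-≤ (offsetCost-block-≤ sameT)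
                        (offsetCost-insertBlocks (k + d) (drop d v) Ts (All.drop⁺ d ∁Pv) PTs u₀≤′ k+d≤ ordered same) ⟩
          bestCost (x ∷ T) + bestCost (concat Ts)
            ≡⟨ sym (trans (cong sum (map-++ _ (x ∷ T) (concat Ts))) (sum-++ (map _ (x ∷ T)) _)) ⟩
          bestCost ((x ∷ T) ++ concat Ts)
            ∎
          where
          open ≤-Reasoning
          d = gap x ∸ k
          R = insertBlocks (k + d) (drop d v) Ts
          k+d≡gx : k + d ≡ gap x
          k+d≡gx = m+[n∸m]≡n k≤gx
          d≤|v| : d ≤ length v
          d≤|v| = ≤-trans (∸-monoˡ-≤ k (≤-trans (bestGap-≤ x u₀) u₀≤)) (≤-reflexive (m+n∸m≡n k (length v)))
          u₀≤′ : length u₀ ≤ (k + d) + length (drop d v)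
          u₀≤′ = subst (length u₀ ≤_) (sym (begin-equality
            (k + d) + length (drop d v) ≡⟨ cong ((k + d) +_) (List.length-drop d v) ⟩
            (k + d) + (length v ∸ d)    ≡⟨ +-assoc k d (length v ∸ d) ⟩
            k + (d + (length v ∸ d))    ≡⟨ cong (k +_) (m+[n∸m]≡n d≤|v|) ⟩
            k + length v                ∎)) u₀≤
          k+d≤ : All (λ y → k + d ≤ gap y) (concat Ts)
          k+d≤ = subst (λ c → All (λ y → c ≤ gap y) (concat Ts)) (sym k+d≡gx)
                   (All.concat⁺ (All.map (λ x≺T′ → All.map (λ rx<ry → bestGap-mono rx<ry u₀) (All.head x≺T′)) x≺Ts))

        Satisfies-insertBlocks : ∀ k v {B Ts} → All (∁ P) v → All (All P) B → Unique (concat B) →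
                                 Pointwise Reordering B Ts → Satisfies (insertBlocks k v Ts) B
        Satisfies-insertBlocks k v ∁Pv []           _  []        = [] , []
        Satisfies-insertBlocks k v {[] ∷ B} {[] ∷ Ts} ∁Pv (_ ∷ PB) uB (_ ∷ reords) =
          let (cs , os) = Satisfies-insertBlocks k v ∁Pv PB uB reords
          in (0 , []) ∷ cs , All.tabulate (λ _ → []) ∷ os
        Satisfies-insertBlocks k v {(y ∷ S) ∷ B} {[] ∷ Ts} ∁Pv _ _ ((S⊆[] , _) ∷ _) = contradiction (S⊆[] (here refl)) λ ()
        Satisfies-insertBlocks k v {S ∷ B} {(x ∷ T) ∷ Ts} ∁Pv (PS ∷ PB) uSB (reord@(_ , T⊆S , _) ∷ reords) =
          Satisfies-++ˡ (take d v) (All.map (All.map (λ Py y∈P → All.lookup (All.take⁺ d ∁Pv) y∈P Py)) (PS ∷ PB))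
            (Consecutive-++ R reord ∷ proj₁ B-in-TR , All.map (Precedes-++ R reord) B∉T ∷ proj₂ B-in-TR)
          where
          d = gap x ∸ k
          R = insertBlocks (k + d) (drop d v) Ts
          uS×uB×disj = Unique-++⁻ S uSB
          B∉T : All (All (_∉ x ∷ T)) B
          B∉T = All.tabulate (λ S′∈B → All.tabulate (λ y∈S′ y∈T →
                  proj₂ (proj₂ uS×uB×disj) (T⊆S y∈T , ∈-concat⁺′ y∈S′ S′∈B)))
          B-in-TR : Satisfies ((x ∷ T) ++ R) B
          B-in-TR = Satisfies-++ˡ (x ∷ T) B∉T
                      (Satisfies-insertBlocks (k + d) (drop d v) (All.drop⁺ d ∁Pv) PB (proj₁ (proj₂ uS×uB×disj)) reords)

  dKT≡inv : ∀ σ π → dKT σ π ≡ Inversions.inv (pos σ) π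
  dKT≡inv σ []      = refl
  dKT≡inv σ (x ∷ π) = begin
    length (filter _ (map (x ,_) π ++ pairs π))
      ≡⟨ cong length (filter-++ _ (map (x ,_) π) (pairs π)) ⟩
    length (filter _ (map (x ,_) π) ++ filter _ (pairs π))
      ≡⟨ length-++ (filter _ (map (x ,_) π)) ⟩
    length (filter _ (map (x ,_) π)) + dKT σ π
      ≡⟨ cong₂ _+_ (pairs-below π) (dKT≡inv σ π) ⟩
    below x π + inv π ∎
    where
    open ≡-Reasoning
    open Inversions (pos σ) using (below; inv)
    pairs-below : ∀ ρ → length (filter (λ (a , b) → pos σ b <? pos σ a) (map (x ,_) ρ)) ≡ below x ρ
    pairs-below []      = refl
    pairs-below (y ∷ ρ) with pos σ y <ᵇ pos σ x
    ... | true  = cong suc (pairs-below ρ)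
    ... | false = pairs-below ρ

  -- The improvement map

  module Improvement (n : ℕ) (πstar : List ℕ) (B : BlockStructure) (πstar↭ : πstar ↭ upTo n)
                     (uB : Unique (concat B)) (B<n : All (All (_< n)) B) (πstar⊨B : Satisfies πstar B) where

    r : ℕ → ℕ
    r = pos πstar

    open Inversions r
    open Split (_∈? concat B)
    open Insert using (insertBlocks; freePart-insertBlocks; blockPart-insertBlocks; insertBlocks-↭;
                       offsetCost-insertBlocks; Satisfies-insertBlocks; SameCost; bestCost; bestCost≤crossCost)

    block : List ℕ → List ℕ
    block S = filter (_∈? S) πstar

    blocks : List (List ℕ)
    blocks = map block B

    improve : List ℕ → List ℕ
    improve π = insertBlocks (freePart π) 0 (freePart π) blocks

    code : List ℕ → List ℕ
    code π = map (pos π) (concat B)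

    ∈πstar : ∀ {x} → x < n → x ∈ πstar
    ∈πstar x<n = ∈-resp-↭ (↭-sym πstar↭) (∈-upTo⁺ x<n)

    uπstar : Unique πstar
    uπstar = Unique-resp-↭ (↭-sym πstar↭) (Unique.upTo⁺ n)

    block⊆ : ∀ S → block S ⊆ S
    block⊆ S x∈ = proj₂ (∈-filter⁻ (_∈? S) {xs = πstar} x∈)

    S⊆πstar : ∀ {S} → S ∈ B → S ⊆ πstar
    S⊆πstar S∈B x∈S = ∈πstar (All.lookup (All.lookup B<n S∈B) x∈S)

    reordering : ∀ {S} → S ∈ B → Reordering S (block S)
    reordering {S} S∈B = S⊆block , block⊆ S ,
      ≤-antisym (Unique-⊆⇒length≤ (Unique.filter⁺ (_∈? S) uπstar) (block⊆ S))
                (Unique-⊆⇒length≤ (All.lookup (Unique-concat⁻ uB) S∈B) S⊆block)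
      where
      S⊆block : S ⊆ block S
      S⊆block x∈S = ∈-filter⁺ (_∈? S) (S⊆πstar S∈B x∈S) x∈S

    blocks-↭ : ∀ {π} → π ↭ πstar → concat blocks ↭ blockPart π
    blocks-↭ π↭ = ↭-sym (↭-trans (filter-↭ (_∈? concat B) π↭) (filter-∈-concat-↭ πstar {B} uB))

    free-free : ∀ π → All (∁ (_∈ concat B)) (freePart π)
    free-free π = All.tabulate (λ x∈ → proj₂ (∈-filter⁻ (∁? (_∈? concat B)) {xs = π} x∈))

    blocks-in-B : All (All (_∈ concat B)) blocks
    blocks-in-B = All.map⁺ (All.tabulate (λ {S} S∈B → All.tabulate (λ x∈ → ∈-concat⁺′ (block⊆ S x∈) S∈B)))

    convex : ∀ {S a x y} → S ∈ B → a ∈ πstar → a ∉ S → x ∈ S → y ∈ S → ¬ (r x < r a × r a < r y)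
    convex S∈B = Consecutive-convex (All.lookup (Unique-concat⁻ uB) S∈B) (S⊆πstar S∈B) (All.lookup (proj₁ πstar⊨B) S∈B)

    above-block : ∀ {S a x y} → S ∈ B → a ∈ πstar → a ∉ S → x ∈ S → y ∈ S → r x < r a → r y < r a
    above-block {S} S∈B a∈ a∉S x∈S y∈S rx<ra with <-cmp (r _) (r _)
    ... | tri< ry<ra _     _     = ry<ra
    ... | tri≈ _     ry≡ra _     = contradiction (subst (_∈ S) (pos-injective (S⊆πstar S∈B y∈S) ry≡ra) y∈S) a∉S
    ... | tri> _     _     ra<ry = contradiction (rx<ra , ra<ry) (convex S∈B a∈ a∉S x∈S y∈S)

    below-block : ∀ {S a x y} → S ∈ B → a ∈ πstar → a ∉ S → x ∈ S → y ∈ S → r a < r x → r a < r y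
    below-block {S} S∈B a∈ a∉S x∈S y∈S ra<rx with <-cmp (r _) (r _)
    ... | tri< ra<ry _     _     = ra<ry
    ... | tri≈ _     ra≡ry _     = contradiction (subst (_∈ S) (pos-injective (S⊆πstar S∈B y∈S) (sym ra≡ry)) y∈S) a∉S
    ... | tri> _     _     ry<ra = contradiction (ry<ra , ra<rx) (convex S∈B a∈ a∉S y∈S x∈S)

    blocks-sameCost : ∀ {π} → π ↭ πstar → All (SameCost (freePart π)) blocks
    blocks-sameCost {π} π↭ = All.map⁺ (All.tabulate λ {S} S∈B {x} {y} x∈T y∈T → cost-cong (freePart π)
      (All.tabulate λ a∈u →
        let a∈π , a∉B = ∈-filter⁻ (∁? (_∈? concat B)) {xs = π} a∈u
            a∈ = ∈-resp-↭ π↭ a∈π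
            a∉S = a∉B ∘ λ a∈S → ∈-concat⁺′ a∈S S∈B
            x∈S = block⊆ S x∈T
            y∈S = block⊆ S y∈T
        in mk⇔ (above-block S∈B a∈ a∉S x∈S y∈S) (above-block S∈B a∈ a∉S y∈S x∈S) ,
           mk⇔ (below-block S∈B a∈ a∉S x∈S y∈S) (below-block S∈B a∈ a∉S y∈S x∈S)))

    blocks-ordered : AllPairs (Precedes r) blocks
    blocks-ordered = AllPairs.map⁺ (AllPairs.map (λ {S} {S′} → Precedes-⊆ (block⊆ S) (block⊆ S′)) (proj₂ πstar⊨B))

    blocks-increasing : AllPairs (λ x y → r x < r y) (concat blocks)
    blocks-increasing = AllPairs.concat⁺
      (All.map⁺ (All.tabulate (λ {S} _ → AllPairs.filter⁺ (_∈? S) (pos-increasing uπstar)))) blocks-ordered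

    improve-↭ : ∀ {π} → π ↭ πstar → improve π ↭ π
    improve-↭ {π} π↭ = begin
      improve π                    ↭⟨ insertBlocks-↭ (freePart π) 0 (freePart π) blocks ⟩
      freePart π ++ concat blocks  ↭⟨ ++⁺ˡ (freePart π) (blocks-↭ π↭) ⟩
      freePart π ++ blockPart π    ↭⟨ ++-comm (freePart π) (blockPart π) ⟩
      blockPart π ++ freePart π    ↭⟨ ↭-sym (filter-∁-↭ (_∈? concat B) π) ⟩
      π                            ∎
      where open PermutationReasoning

    improve-satisfies : ∀ π → Satisfies (improve π) B
    improve-satisfies π = Satisfies-insertBlocks (freePart π) 0 (freePart π) (free-free π)
      (All.tabulate (λ S∈B → All.tabulate (λ x∈S → ∈-concat⁺′ x∈S S∈B))) uB
      (Pointwise-map⁺ (All.tabulate reordering))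

    inv-improve : ∀ {π} → π ↭ πstar → inv (improve π) ≤ inv π
    inv-improve {π} π↭ = begin
      inv (improve π)
        ≡⟨ inv-split (improve π) ⟩
      inv (freePart (improve π)) + inv (blockPart (improve π)) + cross (improve π)
        ≡⟨ cong₂ (λ f b → inv f + inv b + crossCost f (gaps (improve π)))
                 (freePart-insertBlocks u 0 u blocks (free-free π) blocks-in-B)
                 (blockPart-insertBlocks u 0 u blocks (free-free π) blocks-in-B) ⟩
      inv u + inv (concat blocks) + crossCost u (gaps (improve π))
        ≡⟨ cong (λ i → inv u + i + crossCost u (gaps (improve π))) (inv-increasing blocks-increasing) ⟩
      inv u + 0 + crossCost u (gaps (improve π))
        ≤⟨ +-monoʳ-≤ (inv u + 0) (offsetCost-insertBlocks u 0 u blocks (free-free π) blocks-in-B ≤-refl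
                                    (All.tabulate (λ _ → z≤n)) blocks-ordered (blocks-sameCost π↭)) ⟩
      inv u + 0 + bestCost u (concat blocks)
        ≡⟨ cong (inv u + 0 +_) (sum-↭ (map⁺ _ (blocks-↭ π↭))) ⟩
      inv u + 0 + bestCost u (blockPart π)
        ≤⟨ +-mono-≤ (+-monoʳ-≤ (inv u) z≤n)
                    (subst (λ l → bestCost u l ≤ cross π) (proj₁-gaps π) (bestCost≤crossCost u (gaps π))) ⟩
      inv u + inv (blockPart π) + cross π
        ≡⟨ sym (inv-split π) ⟩
      inv π ∎
      where
      open ≤-Reasoning
      u = freePart π

    length≡n : ∀ {π} → π ↭ upTo n → length π ≡ n
    length≡n π↭ = trans (↭-length π↭) (length-upTo n)

    code∈tuples : ∀ {π} → π ↭ upTo n → code π ∈ tuples (totalSize B) n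
    code∈tuples {π} π↭ = subst (λ l → code π ∈ tuples l n) (length-map (pos π) (concat B))
      (∈-tuples (code π) (All.map⁺ (All.map (λ x<n → subst (pos π _ <_) (length≡n π↭)
                                                 (pos<length (∈-resp-↭ (↭-sym π↭) (∈-upTo⁺ x<n))))
                                              (All.concat⁺ B<n))))

    improve-code-injective : ∀ {π₁ π₂} → π₁ ↭ upTo n → π₂ ↭ upTo n → code π₁ ≡ code π₂ → improve π₁ ≡ improve π₂ → π₁ ≡ π₂
    improve-code-injective {π₁} {π₂} π₁↭ π₂↭ code≡ improve≡ =
      filter-pos-injective (_∈? concat B) (trans (length≡n π₁↭) (sym (length≡n π₂↭)))
        (Unique-resp-↭ (↭-sym π₁↭) (Unique.upTo⁺ n)) (Unique-resp-↭ (↭-sym π₂↭) (Unique.upTo⁺ n))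
        (trans (sym (free-improve π₁)) (trans (cong freePart improve≡) (free-improve π₂)))
        (map-≡⇒≡ code≡)
      where
      free-improve : ∀ π → freePart (improve π) ≡ freePart π
      free-improve π = freePart-insertBlocks (freePart π) 0 (freePart π) blocks (free-free π) blocks-in-B

    weight-improve : ∀ {φ} → 0ℚ ℚ.≤ φ → φ ℚ.≤ 1ℚ → ∀ {π} → π ↭ upTo n → weight φ πstar π ℚ.≤ weight φ πstar (improve π)
    weight-improve φ≥0 φ≤1 {π} π↭ = ^ℚ-antitone φ≥0 φ≤1
      (subst₂ _≤_ (sym (dKT≡inv πstar (improve π))) (sym (dKT≡inv πstar π)) (inv-improve (↭-trans π↭ (↭-sym πstar↭))))

    improve-satisfying : ∀ {π} → π ∈ Perms n → improve π ∈ filter (λ σ → satisfies σ B Bool.≟ true) (Perms n)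
    improve-satisfying {π} π∈ =
      ∈-filter⁺ (λ σ → satisfies σ B Bool.≟ true) (∈-perms⁺ (upTo n) (↭-trans (improve-↭ (↭-trans π↭ (↭-sym πstar↭))) π↭))
                (to T-≡ (satisfies⁺ (improve π) B (improve-satisfies π)))
      where π↭ = ∈-perms⁻ (upTo n) π∈

open import Defs
open import Data.Nat using (ℕ)
import Data.Nat
open import Data.List using (List; length; concat)
open import Data.List.Relation.Unary.All using (All)
open import Data.List.Relation.Unary.Unique.Propositional using (Unique)
open import Data.List.Relation.Binary.Permutation.Propositional using (_↭_)
open import Data.List using (upTo)
open import Data.Bool using (true)
open import Data.Rational using (ℚ; 0ℚ; 1ℚ; _≤_; _<_; _*_; _/_)
open import Data.Integer using (+_)
open import Relation.Binary.PropositionalEquality using (_≡_)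

open import Data.Bool.Properties using (T-≡)
import Data.Bool
open import Data.List using (filter)
open import Data.List.Relation.Unary.Unique.Propositional.Properties using (upTo⁺)
open import Data.Rational using (nonNegative)
open import Data.Rational.Properties using (<⇒≤; *-monoʳ-≤-nonNeg; module ≤-Reasoning)
open import Function using (Equivalence; _∘_)
open import Relation.Binary.PropositionalEquality using (cong)
open MallowsBlocks

lemma3p4 : (n : ℕ) (φ : ℚ) → 0ℚ < φ → φ ≤ 1ℚ →
    (πstar : List ℕ) → πstar ↭ upTo n →
    (B : BlockStructure) → Unique (concat B) → All (All (Data.Nat._< n)) B →
    satisfies πstar B ≡ true →
    Z n φ πstar ≤ ((+ (n Data.Nat.^ (2 Data.Nat.* totalSize B))) / 1) * massB n φ πstar B
lemma3p4 n φ 0<φ φ≤1 πstar πstar↭ B uB B<n πstar⊨B = begin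
  Z n φ πstar                                              ≤⟨ Z≤codes*massB ⟩
  toℚ (length (tuples ℓ n)) * massB n φ πstar B           ≡⟨ cong (λ k → toℚ k * massB n φ πstar B) (length-tuples ℓ n) ⟩
  toℚ (n Data.Nat.^ ℓ) * massB n φ πstar B                ≤⟨ *-monoʳ-≤-nonNeg (massB n φ πstar B) {{nonNegative massB≥0}}
                                                                (toℚ-mono (^≤^2* n ℓ)) ⟩
  toℚ (n Data.Nat.^ (2 Data.Nat.* ℓ)) * massB n φ πstar B ∎
  where
  open ≤-Reasoning
  open Improvement n πstar B πstar↭ uB B<n (satisfies⁻ πstar B (Equivalence.from T-≡ πstar⊨B))
  ℓ = totalSize B
  φ≥0 = <⇒≤ 0<φ
  weight≥0 : ∀ π → 0ℚ ≤ weight φ πstar π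
  weight≥0 π = ^ℚ-nonNeg φ≥0 (dKT πstar π)
  massB≥0 : 0ℚ ≤ massB n φ πstar B
  massB≥0 = sumℚ-nonNeg weight≥0 (filter (λ π → satisfies π B Data.Bool.≟ true) (Perms n))
  Z≤codes*massB : Z n φ πstar ≤ toℚ (length (tuples ℓ n)) * massB n φ πstar B
  Z≤codes*massB = sumℚ-≤-coding (weight φ πstar) improve code weight≥0 (Unique-perms (upTo⁺ n))
    (weight-improve φ≥0 φ≤1 ∘ ∈-perms⁻ (upTo n)) improve-satisfying (code∈tuples ∘ ∈-perms⁻ (upTo n))
    (λ π₁∈ π₂∈ → improve-code-injective (∈-perms⁻ (upTo n) π₁∈) (∈-perms⁻ (upTo n) π₂∈))
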